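{- Let $G$ be an embedded graph and $e\in E(G)$. Then (1) $P(G;\lambda)=P(G/e;\lambda)-P(G^{\tau(e)}/e;\lambda)$; (2) $P(G;\lambda)=P(G/e;\lambda)-P(G^{\tau\delta(e)}/e;\lambda)$; (3) $P(G^{\delta\tau(e)};\lambda)=P(G-e;\lambda)-P(G/e;\lambda)$.
   Context: An embedded graph is a graph cellularly embedded in a closed (possibly non-orientable) surface, up to homeomorphism; equivalently a ribbon graph, encoded by an arrow presentation: one circle per vertex carrying disjoint arrows, each edge label appearing on exactly two arrows (the attaching arcs of that edge, oriented consistently with an orientation of the edge disc); equivalent up to reversing both arrows of a label and relabelling. For an edge $e$: $G^{\tau(e)}$ is obtained by reversing exactly one of the two arrows labelled $e$ (half-twist). $G^{\delta(e)}$ (partial dual): if $A,B$ are the arrows labelled $e$, draw a segment with an arrow from the head of $A$ to the tail of $B$ and one from the head of $B$ to the tail of $A$, label both $e$, and delete $A$ and $B$ with the arcs containing them, the segments becoming arcs of new circles. Composite operations act right to left: $G^{\delta\tau(e)}:=(G^{\tau(e)})^{\delta(e)}$, $G^{\tau\delta(e)}:=(G^{\delta(e)})^{\tau(e)}$. $G-e$ is deletion of the edge $e$, and contraction of any edge (loop or not) is defined by $H/e:=H^{\delta(e)}-e$; thus $G^{\tau(e)}/e=(G^{\tau(e)})^{\delta(e)}-e$ and $G^{\tau\delta(e)}/e=((G^{\delta(e)})^{\tau(e)})^{\delta(e)}-e$. Penrose polynomial: the medial graph $G_m$ has a degree-4 vertex $v_e$ on each edge $e$ of $G$, with edges following face boundaries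 of $G$ (an isolated vertex contributes a vertex-free closed curve); faces of $G_m$ containing a vertex of $G$ are black, others white. At $v_e$, the white split pairs consecutive half-edges bounding white corners, the black split those bounding black corners, the crossing pairs opposite half-edges. A state $s$ chooses a vertex state at each vertex; $c(s)$ = number of resulting closed curves, $cr(s)$ = number of crossings; Penrose states have no black splits; $P(G;\lambda)=\sum_{s\text{ Penrose}}(-1)^{cr(s)}\lambda^{c(s)}$. -}

module Defs where

open import Data.Nat using (ℕ; zero; suc; _+_; _*_; _≤ᵇ_; _≡ᵇ_)
open import Data.Bool using (Bool; true; false; not; if_then_else_; _∧_)
open import Data.Fin using (Fin; zero; suc; toℕ; punchIn)
open import Data.Product using (_×_; _,_)
open import Data.Maybe using (Maybe; just; nothing; fromMaybe)
import Data.Maybe as Maybe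
open import Data.List using (List; []; _∷_; _++_; map; concatMap; foldr; allFin; length; filterᵇ)
open import Data.Vec using (Vec; []; _∷_; lookup)
import Data.Vec as Vec
open import Data.Integer using (ℤ; +_; -[1+_])
import Data.Integer as ℤ
open import Relation.Binary.PropositionalEquality using (_≡_; _≢_)

-- An embedded graph with m edges (labelled by Fin m) is encoded as:
--  * each edge e carries two arrows, (e , false) = "A" and (e , true) = "B";
--  * each arrow has two endpoints, tail (false) and head (true);
--    so the endpoints ("points") are  Fin m × Bool × Bool;
--  * the arcs of the vertex circles lying between consecutive arrow
--    endpoints are recorded by a fixed-point-free involution σ on the points
--    (σ p = q iff a circle arc free of arrows joins p to q);
--    the circles are the cycles formed by arrows together with these arcs;
--  * iso = the number of circles carrying no arrows (isolated vertices).

Point : ℕ → Set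
Point m = Fin m × Bool × Bool

record AP (m : ℕ) : Set where
  constructor ap
  field
    iso : ℕ
    σ   : Point m → Point m
open AP public

Valid : ∀ {m} → AP m → Set
Valid G = (∀ p → σ G (σ G p) ≡ p) × (∀ p → σ G p ≢ p)

code : ∀ {m} → Point m → ℕ
code (e , a , h) = 4 * toℕ e + 2 * (if a then 1 else 0) + (if h then 1 else 0)

_==_ : ∀ {m} → Point m → Point m → Bool
p == q = code p ≡ᵇ code q

isEdge : ∀ {m} → Fin m → Point m → Bool
isEdge e (e' , _ , _) = toℕ e ≡ᵇ toℕ e'

-- Twist τ(e): reverse the arrow (e , false).  New point names are mapped
-- to the old physical points by f (an involution), σ' = f ∘ σ ∘ f.

twistMap : ∀ {m} → Fin m → Point m → Point m
twistMap e (e' , a , h) =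
  if isEdge e (e' , a , h) ∧ not a then (e' , a , not h) else (e' , a , h)

twist : ∀ {m} → Fin m → AP m → AP m
twist e G = ap (iso G) (λ p → twistMap e (σ G (twistMap e p)))

-- With A = (e,false), B = (e,true):
-- new arrow A' runs from head A to tail B, new arrow B' from head B to
-- tail A; the old arrows and their arcs are removed, the circle arcs
-- between arrows are unchanged.  dualTo sends a new point name to the old
-- physical point, dualFrom is its inverse; σ' = dualFrom ∘ σ ∘ dualTo.

dualTo : ∀ {m} → Fin m → Point m → Point m
dualTo e (e' , a , h) = if isEdge e (e' , a , h) then g a h else (e' , a , h)
  where
  g : Bool → Bool → _
  g false false = (e' , false , true)   -- tail A' = head A
  g false true  = (e' , true  , false)  -- head A' = tail B
  g true  false = (e' , true  , true)   -- tail B' = head B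
  g true  true  = (e' , false , false)  -- head B' = tail A

dualFrom : ∀ {m} → Fin m → Point m → Point m
dualFrom e (e' , a , h) = if isEdge e (e' , a , h) then g a h else (e' , a , h)
  where
  g : Bool → Bool → _
  g false true  = (e' , false , false)
  g true  false = (e' , false , true)
  g true  true  = (e' , true  , false)
  g false false = (e' , true  , true)

pdual : ∀ {m} → Fin m → AP m → AP m
pdual e G = ap (iso G) (λ p → dualFrom e (σ G (dualTo e p)))

-- Deletion G - e.  Remove both arrows labelled e; arcs of the circles are
-- joined through the removed arrows.  Circles carrying only arrows
-- labelled e become isolated vertices.

down : ∀ {n} → Fin (suc n) → Fin (suc n) → Maybe (Fin n)
down zero zero = nothing
down zero (suc x) = just x
down {suc n} (suc e) zero = just zero
down {suc n} (suc e) (suc x) = Maybe.map suc (down e x)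

downPt : ∀ {n} → Fin (suc n) → Point (suc n) → Maybe (Point n)
downPt e (x , a , h) = Maybe.map (λ y → (y , a , h)) (down e x)

upPt : ∀ {n} → Fin (suc n) → Point n → Point (suc n)
upPt e (x , a , h) = (punchIn e x , a , h)

passThrough : ∀ {n} → AP (suc n) → Fin (suc n) → Point (suc n) → Point (suc n)
passThrough G e (x , a , h) =
  if isEdge e (x , a , h) then σ G (x , a , not h) else (x , a , h)

-- number of circles of G carrying only arrows labelled e
onlyECircles : ∀ {n} → AP (suc n) → Fin (suc n) → ℕ
onlyECircles G e =
  b2n (σ G tA == hA) + b2n (σ G tB == hB) + b2n (inB (σ G hA) ∧ inB (σ G tA))
  where
  b2n : Bool → ℕ
  b2n b = if b then 1 else 0
  tA hA tB hB : Point _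
  tA = (e , false , false)
  hA = (e , false , true)
  tB = (e , true , false)
  hB = (e , true , true)
  inB : Point _ → Bool
  inB (x , a , h) = isEdge e (x , a , h) ∧ a

delete : ∀ {n} → AP (suc n) → Fin (suc n) → AP n
delete G e = ap (iso G + onlyECircles G e) σ'
  where
  σ' : Point _ → Point _
  σ' p = fromMaybe p
           (downPt e (passThrough G e (passThrough G e (σ G (upPt e p)))))

contract : ∀ {n} → AP (suc n) → Fin (suc n) → AP n
contract G e = delete (pdual e G) e

-- The medial vertex v_e has four half-edges, one at each endpoint of the
-- arrows A,B labelled e; medial edges are the circle arcs (σ).  In cyclic
-- order the corners are tA,hA,tB,hB; black corners face the vertex discs
-- ({tA,hA},{tB,hB}); white corners face the sides of the edge ribbon
-- ({hA,tB},{hB,tA}).  A Penrose state chooses at each edge the white split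
-- (false) or the crossing (true, pairs {tA,tB},{hA,hB}).

allPoints : ∀ m → List (Point m)
allPoints m = concatMap (λ e → concatMap (λ a → map (λ h → (e , a , h))
                (true ∷ false ∷ [])) (true ∷ false ∷ [])) (allFin m)

statePair : ∀ {m} → Vec Bool m → Point m → Point m
statePair s (e , a , h) = if lookup s e then (e , not a , h) else (e , not a , not h)

iterate : ∀ {A : Set} → (A → A) → ℕ → A → List A
iterate f zero x = []
iterate f (suc k) x = x ∷ iterate f k (f x)

-- the closed curve (component of the union of the two perfect matchings
-- σ and statePair s) through p
curve : ∀ {m} → AP m → Vec Bool m → Point m → List (Point m)
curve {m} G s p =
  concatMap (λ q → q ∷ statePair s q ∷ [])
    (iterate (λ q → σ G (statePair s q)) (4 * m) p)

allᵇ : ∀ {A : Set} → (A → Bool) → List A → Bool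
allᵇ f [] = true
allᵇ f (x ∷ xs) = f x ∧ allᵇ f xs

isRep : ∀ {m} → AP m → Vec Bool m → Point m → Bool
isRep G s p = allᵇ (λ q → code p ≤ᵇ code q) (curve G s p)

-- c(s): number of closed curves (isolated vertices give one curve each)
numCurves : ∀ {m} → AP m → Vec Bool m → ℕ
numCurves {m} G s = iso G + length (filterᵇ (isRep G s) (allPoints m))

numCross : ∀ {m} → Vec Bool m → ℕ
numCross [] = 0
numCross (true ∷ s) = suc (numCross s)
numCross (false ∷ s) = numCross s

allStates : ∀ m → List (Vec Bool m)
allStates zero = [] ∷ []
allStates (suc m) = concatMap (λ s → (true ∷ s) ∷ (false ∷ s) ∷ []) (allStates m)

sumℤ : List ℤ → ℤ
sumℤ = foldr ℤ._+_ (+ 0)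

-- coefficient of λ^k in the Penrose polynomial P(G;λ)
penroseCoeff : ∀ {m} → AP m → ℕ → ℤ
penroseCoeff {m} G k =
  sumℤ (map (λ s → if numCurves G s ≡ᵇ k then (-[1+ 0 ] ℤ.^ numCross s) else + 0)
            (allStates m))

_−P_ : (ℕ → ℤ) → (ℕ → ℤ) → (ℕ → ℤ)
(f −P g) k = f k ℤ.- g k

-- Sort the vertex states by their choice at e. The white split at e turns a state of G into
-- a state of G/e with the same curves, and the crossing into a state of G^τ(e)/e (or of
-- G^τδ(e)/e) with the same curves and one crossing fewer; for G^δτ(e) the white split gives
-- G - e and the crossing G/e. With the sign (-1)^cr this gives (1)-(3).
-- The five identifications are proved alike. Twists and partial duals only permute the four
-- ends of e, so relabelling those ends conjugates the arc matching, which keeps the number of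
-- curves, and turns the state at e into the black split, which runs along both arrows of e.
-- With the black split at e, the curves through points off e are those of the graph with e
-- deleted, with the passages along e cut out, and the other curves consist of ends of e only:
-- they are the circles carrying only arrows of e, which the deletion turns into isolated
-- vertices. Curves are counted through their point of least code, and any two sets meeting
-- every curve exactly once have the same size, by double counting.
module Submission where

open import Defs
open import Algebra.Properties.CommutativeSemigroup using (interchange)
import Algebra.Properties.CommutativeMonoid.Sum as MonoidSum
open import Data.Bool using (Bool; true; false; T; _∧_; _∨_; not; if_then_else_)
import Data.Bool.Properties as Bool
open import Data.Bool.Properties using (not-involutive; not-¬; ¬-not)
open import Data.Fin using (Fin; zero; suc; #_; combine; toℕ; punchIn; punchOut)
import Data.Fin.Properties as Fin
open import Data.Fin.Properties
  using (punchInᵢ≢i; punchIn-punchOut; pigeonhole; toℕ<n; combine-injectiveˡ; combine-injectiveʳ; toℕ-combine; toℕ-injective)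
open import Data.Integer using (ℤ)
import Data.Integer as ℤ
import Data.Integer.Properties as ℤ
open import Data.List using (List; []; _∷_; map; concatMap; allFin; length; filterᵇ; tabulate)
import Data.List as List
open import Data.List.Extrema.Nat using (argmin; argmin-sel; f[argmin]≤f[xs])
open import Data.List.Membership.Propositional using (_∈_; find; lose)
open import Data.List.Membership.Propositional.Properties using (∈-concatMap⁺; ∈-concatMap⁻)
open import Data.List.Properties using (map-++; map-cong)
import Data.List.Relation.Unary.All as All
open import Data.List.Relation.Unary.Any using (here; there; any?)
open import Data.Maybe using (just; nothing; fromMaybe; maybe′)
import Data.Maybe as Maybe
open import Data.Maybe.Properties using (just-injective)
open import Data.Nat using (ℕ; zero; suc; _+_; _*_; _∸_; _≤_; _<_; s≤s; _≤ᵇ_; _≡ᵇ_)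
open import Data.Nat.ListAction using (sum)
open import Data.Nat.ListAction.Properties using (sum-++)
open import Data.Nat.Properties
  using (+-0-commutativeMonoid; +-commutativeSemigroup; +-assoc; +-comm; +-identityʳ; +-suc; *-comm; ≤-reflexive; ≤-trans;
         ≤-pred; <⇒≤; ≤-antisym; m∸n≤m; m<n⇒0<n∸m; m+[n∸m]≡n; m≤n⇒m<n∨m≡n; ≤ᵇ⇒≤; ≤⇒≤ᵇ; ≡ᵇ⇒≡; ≡⇒≡ᵇ)
open import Data.Product using (_×_; _,_; proj₁; proj₂; ∃; ∃₂; ∃-syntax; ∃!; uncurry)
open import Data.Product.Properties using (≡-dec)
open import Data.Sum using (_⊎_; inj₁; inj₂)
open import Data.Vec using (Vec; []; _∷_; insertAt; lookup)
open import Data.Vec.Properties using (insertAt-lookup; insertAt-punchIn)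
open import Function using (_∘_; const; id)
open import Function.Bundles using (Equivalence)
open import Relation.Binary.Definitions using (DecidableEquality)
open import Relation.Binary.PropositionalEquality
open import Relation.Nullary using (¬_; Dec; yes; no; ⌊_⌋; contradiction)
open import Relation.Nullary.Decidable using (toWitness; fromWitness; map′)

open MonoidSum +-0-commutativeMonoid using (sum-syntax; sum-cong-≗; ∑-distrib-+; sum-replicate-zero; sum-remove)
  renaming (sum to ∑ᶠ)

-- Spelled as Defs spells its 0/1 values, so that code and onlyECircles unfold to 𝟙.
𝟙 : Bool → ℕ
𝟙 b = if b then 1 else 0

𝟙-∨ : ∀ {a b} → ¬ (T a × T b) → 𝟙 (a ∨ b) ≡ 𝟙 a + 𝟙 b
𝟙-∨ {true} {true} exclusive = contradiction (_ , _) exclusive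
𝟙-∨ {true} {false} _ = refl
𝟙-∨ {false} _ = refl

T-∧⁺ : ∀ {a b} → T a → T b → T (a ∧ b)
T-∧⁺ {true} _ tb = tb

T-∧ˡ : ∀ {a b} → T (a ∧ b) → T a
T-∧ˡ {true} _ = _

T-∧ʳ : ∀ {a b} → T (a ∧ b) → T b
T-∧ʳ {true} tb = tb

T-∨ˡ : ∀ {a b} → T a → T (a ∨ b)
T-∨ˡ {true} _ = _

T-∨ʳ : ∀ {a b} → T b → T (a ∨ b)
T-∨ʳ {true} _ = _
T-∨ʳ {false} tb = tb

≡-or-≡-not : ∀ x y → x ≡ y ⊎ x ≡ not y
≡-or-≡-not false false = inj₁ refl
≡-or-≡-not false true = inj₂ refl
≡-or-≡-not true false = inj₂ refl
≡-or-≡-not true true = inj₁ refl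

allᵇ⁻ : ∀ {A : Set} {f : A → Bool} {xs x} → T (allᵇ f xs) → x ∈ xs → T (f x)
allᵇ⁻ {f = f} {y ∷ xs} t (here refl) = T-∧ˡ {f y} t
allᵇ⁻ {f = f} {y ∷ xs} t (there x∈) = allᵇ⁻ (T-∧ʳ {f y} t) x∈

allᵇ⁺ : ∀ {A : Set} {f : A → Bool} xs → (∀ {x} → x ∈ xs → T (f x)) → T (allᵇ f xs)
allᵇ⁺ [] _ = _
allᵇ⁺ (x ∷ xs) all = T-∧⁺ (all (here refl)) (allᵇ⁺ xs (all ∘ there))

unique-true≡⌊≟⌋ : ∀ {A : Set} (_≟_ : DecidableEquality A) (d : A → Bool) →
  (u : ∃! _≡_ (T ∘ d)) → ∀ y → d y ≡ ⌊ y ≟ proj₁ u ⌋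
unique-true≡⌊≟⌋ _≟_ d (w , dw , unique) y with d y in dy | y ≟ w
... | true  | yes _ = refl
... | true  | no y≢w = contradiction (sym (unique (subst T (sym dy) _))) y≢w
... | false | yes refl = contradiction (subst T dy dw) id
... | false | no _ = refl

-- The end (a , h) of an arrow of an edge: a chooses the arrow A/B, h its tail/head.
Corner : Set
Corner = Bool × Bool

_≟ᶜ_ : DecidableEquality Corner
_≟ᶜ_ = ≡-dec Bool._≟_ Bool._≟_

corners : List Corner
corners = (false , false) ∷ (false , true) ∷ (true , false) ∷ (true , true) ∷ []

∈-corners : ∀ c → c ∈ corners
∈-corners (false , false) = here refl
∈-corners (false , true) = there (here refl)
∈-corners (true , false) = there (there (here refl))
∈-corners (true , true) = there (there (there (here refl)))

_≟ᴾ_ : ∀ {m} → DecidableEquality (Point m)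
_≟ᴾ_ = ≡-dec Fin._≟_ _≟ᶜ_

cornerIndex : Corner → Fin 4
cornerIndex (false , false) = # 0
cornerIndex (false , true) = # 1
cornerIndex (true , false) = # 2
cornerIndex (true , true) = # 3

cornerIndex-injective : ∀ {c c'} → cornerIndex c ≡ cornerIndex c' → c ≡ c'
cornerIndex-injective {c} {c'} eq = trans (sym (lookup-cornerIndex c)) (trans (cong (List.lookup corners) eq) (lookup-cornerIndex c'))
  where
  lookup-cornerIndex : ∀ c → List.lookup corners (cornerIndex c) ≡ c
  lookup-cornerIndex (false , false) = refl
  lookup-cornerIndex (false , true) = refl
  lookup-cornerIndex (true , false) = refl
  lookup-cornerIndex (true , true) = refl

pointIndex : ∀ {m} → Point m → Fin (m * 4)
pointIndex (e , c) = combine e (cornerIndex c)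

pointIndex-injective : ∀ {m} {p q : Point m} → pointIndex p ≡ pointIndex q → p ≡ q
pointIndex-injective {p = e , c} {e' , c'} eq
  with refl ← combine-injectiveˡ e _ e' _ eq
  with refl ← cornerIndex-injective {c} {c'} (combine-injectiveʳ e (cornerIndex c) e (cornerIndex c') eq) = refl

code≡toℕ∘pointIndex : ∀ {m} (p : Point m) → code p ≡ toℕ (pointIndex p)
code≡toℕ∘pointIndex (e , a , h) = begin
  4 * toℕ e + 2 * 𝟙 a + 𝟙 h              ≡⟨ +-assoc (4 * toℕ e) (2 * 𝟙 a) (𝟙 h) ⟩
  4 * toℕ e + (2 * 𝟙 a + 𝟙 h)            ≡⟨ cong (4 * toℕ e +_) (toℕ-cornerIndex a h) ⟩
  4 * toℕ e + toℕ (cornerIndex (a , h))  ≡⟨ toℕ-combine e (cornerIndex (a , h)) ⟨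
  toℕ (combine e (cornerIndex (a , h)))  ∎
  where
  open ≡-Reasoning
  toℕ-cornerIndex : ∀ a h → 2 * 𝟙 a + 𝟙 h ≡ toℕ (cornerIndex (a , h))
  toℕ-cornerIndex false false = refl
  toℕ-cornerIndex false true = refl
  toℕ-cornerIndex true false = refl
  toℕ-cornerIndex true true = refl

code-injective : ∀ {m} {p q : Point m} → code p ≡ code q → p ≡ q
code-injective {p = p} {q} eq =
  pointIndex-injective (toℕ-injective (trans (sym (code≡toℕ∘pointIndex p)) (trans eq (code≡toℕ∘pointIndex q))))

==⇒≡ : ∀ {m} {p q : Point m} → T (p == q) → p ≡ q
==⇒≡ {p = p} {q} t = code-injective (≡ᵇ⇒≡ (code p) (code q) t)

==-refl : ∀ {m} (p : Point m) → T (p == p)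
==-refl p = ≡⇒≡ᵇ (code p) (code p) refl

module _ {n} (e : Fin (suc n)) where

  isEdge-self : ∀ a h → isEdge e (e , a , h) ≡ true
  isEdge-self a h = Equivalence.to Bool.T-≡ (≡⇒≡ᵇ (toℕ e) (toℕ e) refl)

  isEdge-upPt : ∀ p → isEdge e (upPt e p) ≡ false
  isEdge-upPt (i , a , h) with isEdge e (upPt e (i , a , h)) in eq
  ... | false = refl
  ... | true = contradiction (toℕ-injective (≡ᵇ⇒≡ (toℕ e) _ (Equivalence.from Bool.T-≡ eq))) (punchInᵢ≢i e i ∘ sym)

  e≢upPt : ∀ {a h} p → (e , a , h) ≢ upPt e p
  e≢upPt {a} {h} p eq = contradiction (trans (sym (isEdge-self a h)) (trans (cong (isEdge e) eq) (isEdge-upPt p))) λ ()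

  data EdgeView : Point (suc n) → Set where
    on-e : ∀ a h → EdgeView (e , a , h)
    off-e : ∀ p → EdgeView (upPt e p)

  edgeView : ∀ q → EdgeView q
  edgeView (x , a , h) with e Fin.≟ x
  ... | yes refl = on-e a h
  ... | no e≢x = subst EdgeView (cong (_, a , h) (punchIn-punchOut e≢x)) (off-e (punchOut e≢x , a , h))

  downPt-upPt : ∀ p → downPt e (upPt e p) ≡ just p
  downPt-upPt (i , a , h) = cong (Maybe.map (_, a , h)) (down-punchIn e i)
    where
    down-punchIn : ∀ {n} (e : Fin (suc n)) i → down e (punchIn e i) ≡ just i
    down-punchIn zero i = refl
    down-punchIn {suc n} (suc e) zero = refl
    down-punchIn {suc n} (suc e) (suc i) = cong (Maybe.map suc) (down-punchIn e i)

  downPt-self : ∀ a h → downPt e (e , a , h) ≡ nothing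
  downPt-self a h = cong (Maybe.map (_, a , h)) (down-self e)
    where
    down-self : ∀ {n} (e : Fin (suc n)) → down e e ≡ nothing
    down-self zero = refl
    down-self {suc n} (suc e) = cong (Maybe.map suc) (down-self e)

  upPt-injective : ∀ {p q} → upPt e p ≡ upPt e q → p ≡ q
  upPt-injective {p} {q} eq = just-injective (trans (sym (downPt-upPt p)) (trans (cong (downPt e) eq) (downPt-upPt q)))

record IsLinear {A : Set} (S : (A → ℕ) → ℕ) : Set where
  field
    S-cong : ∀ {f g} → f ≗ g → S f ≡ S g
    S-+ : ∀ f g → S (λ x → f x + g x) ≡ S f + S g
    S-0 : S (const 0) ≡ 0
open IsLinear

sum𝔹 : (Bool → ℕ) → ℕ
sum𝔹 g = g true + g false

∑ᴾ : ∀ m → (Point m → ℕ) → ℕ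
∑ᴾ m g = ∑[ i < m ] sum𝔹 λ a → sum𝔹 λ h → g (i , a , h)

count : ∀ {m} → (Point m → Bool) → ℕ
count {m} P = ∑ᴾ m (𝟙 ∘ P)

sum𝔹-linear : IsLinear sum𝔹
sum𝔹-linear = record
  { S-cong = λ f≗g → cong₂ _+_ (f≗g true) (f≗g false)
  ; S-+ = λ f g → interchange +-commutativeSemigroup (f true) (g true) (f false) (g false)
  ; S-0 = refl
  }

∑-linear : ∀ n → IsLinear (∑ᶠ {n})
∑-linear n = record { S-cong = sum-cong-≗ ; S-+ = ∑-distrib-+ ; S-0 = sum-replicate-zero n }

∑ᴾ-linear : ∀ m → IsLinear (∑ᴾ m)
∑ᴾ-linear m = record
  { S-cong = λ f≗g → S-cong (∑-linear m) λ i → S-cong sum𝔹-linear λ a → S-cong sum𝔹-linear λ h → f≗g (i , a , h)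
  ; S-+ = λ f g → trans
      (S-cong (∑-linear m) λ i → trans
        (S-cong sum𝔹-linear λ a → S-+ sum𝔹-linear (λ h → f (i , a , h)) (λ h → g (i , a , h)))
        (S-+ sum𝔹-linear (λ a → sum𝔹 λ h → f (i , a , h)) (λ a → sum𝔹 λ h → g (i , a , h))))
      (S-+ (∑-linear m) (λ i → sum𝔹 λ a → sum𝔹 λ h → f (i , a , h)) (λ i → sum𝔹 λ a → sum𝔹 λ h → g (i , a , h)))
  ; S-0 = S-0 (∑-linear m)
  }

module _ {A : Set} {S : (A → ℕ) → ℕ} (S-linear : IsLinear S) where

  sum𝔹-commute : (f : Bool → A → ℕ) → sum𝔹 (λ a → S (f a)) ≡ S (λ x → sum𝔹 (λ a → f a x))
  sum𝔹-commute f = sym (S-+ S-linear (f true) (f false))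

  ∑-commute : ∀ n (f : Fin n → A → ℕ) → ∑[ i < n ] S (f i) ≡ S (λ x → ∑[ i < n ] f i x)
  ∑-commute zero f = sym (S-0 S-linear)
  ∑-commute (suc n) f = trans (cong (S (f zero) +_) (∑-commute n (f ∘ suc))) (sym (S-+ S-linear _ _))

  ∑ᴾ-commute : ∀ m (f : Point m → A → ℕ) → ∑ᴾ m (λ p → S (f p)) ≡ S (λ x → ∑ᴾ m (λ p → f p x))
  ∑ᴾ-commute m f = trans
    (S-cong (∑-linear m) λ i → trans
      (S-cong sum𝔹-linear λ a → sum𝔹-commute λ h → f (i , a , h))
      (sum𝔹-commute λ a x → sum𝔹 λ h → f (i , a , h) x))
    (∑-commute m λ i x → sum𝔹 λ a → sum𝔹 λ h → f (i , a , h) x)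

∑ᴾ-remove : ∀ {n} (e : Fin (suc n)) (g : Point (suc n) → ℕ) →
  ∑ᴾ (suc n) g ≡ sum𝔹 (λ a → sum𝔹 λ h → g (e , a , h)) + ∑ᴾ n (g ∘ upPt e)
∑ᴾ-remove e g = sum-remove {i = e} (λ i → sum𝔹 λ a → sum𝔹 λ h → g (i , a , h))

length-filterᵇ : ∀ {A : Set} (P : A → Bool) xs → length (filterᵇ P xs) ≡ sum (map (𝟙 ∘ P) xs)
length-filterᵇ P [] = refl
length-filterᵇ P (x ∷ xs) with P x
... | true = cong suc (length-filterᵇ P xs)
... | false = length-filterᵇ P xs

sum-map-concatMap : ∀ {A B : Set} (g : B → ℕ) (F : A → List B) xs →
  sum (map g (concatMap F xs)) ≡ sum (map (λ x → sum (map g (F x))) xs)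
sum-map-concatMap g F [] = refl
sum-map-concatMap g F (x ∷ xs) = trans (cong sum (map-++ g (F x) _))
  (trans (sum-++ (map g (F x)) _) (cong (sum (map g (F x)) +_) (sum-map-concatMap g F xs)))

sum-map-tabulate : ∀ {A : Set} n (f : Fin n → A) (g : A → ℕ) → sum (map g (tabulate f)) ≡ ∑[ i < n ] g (f i)
sum-map-tabulate zero f g = refl
sum-map-tabulate (suc n) f g = cong (g (f zero) +_) (sum-map-tabulate n (f ∘ suc) g)

length-filterᵇ-allPoints : ∀ {m} (P : Point m → Bool) → length (filterᵇ P (allPoints m)) ≡ count P
length-filterᵇ-allPoints {m} P = begin
  length (filterᵇ P (allPoints m))                              ≡⟨ length-filterᵇ P (allPoints m) ⟩
  sum (map (𝟙 ∘ P) (allPoints m))                               ≡⟨ sum-map-concatMap (𝟙 ∘ P) _ (allFin m) ⟩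
  sum (map (λ i → sum (map (𝟙 ∘ P) (ends i))) (allFin m))       ≡⟨ sum-map-tabulate m id _ ⟩
  ∑[ i < m ] sum (map (𝟙 ∘ P) (ends i))                         ≡⟨ sum-cong-≗ ends-sum ⟩
  count P                                                        ∎
  where
  open ≡-Reasoning
  ends : Fin m → List (Point m)
  ends i = (i , true , true) ∷ (i , true , false) ∷ (i , false , true) ∷ (i , false , false) ∷ []
  ends-sum : ∀ i → sum (map (𝟙 ∘ P) (ends i)) ≡ sum𝔹 λ a → sum𝔹 λ h → 𝟙 (P (i , a , h))
  ends-sum i rewrite +-identityʳ (𝟙 (P (i , false , false))) = sym (+-assoc (𝟙 (P (i , true , true))) _ _)

sum𝔹²-unique : (c : Bool → Bool → Bool) → ∃! _≡_ (T ∘ uncurry c) → sum𝔹 (λ a → sum𝔹 λ h → 𝟙 (c a h)) ≡ 1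
sum𝔹²-unique c u@((a₀ , h₀) , _) =
  trans (S-cong sum𝔹-linear λ a → S-cong sum𝔹-linear λ h → cong 𝟙 (unique-true≡⌊≟⌋ _≟ᶜ_ _ u (a , h)))
        (indicator a₀ h₀)
  where
  indicator : ∀ a₀ h₀ → sum𝔹 (λ a → sum𝔹 λ h → 𝟙 ⌊ (a , h) ≟ᶜ (a₀ , h₀) ⌋) ≡ 1
  indicator true true = refl
  indicator true false = refl
  indicator false true = refl
  indicator false false = refl

count-unique : ∀ {m} (d : Point m → Bool) → ∃! _≡_ (T ∘ d) → count d ≡ 1
count-unique {suc n} d ((e , a₀ , h₀) , dw , unique) = begin
  count d                                                          ≡⟨ ∑ᴾ-remove e (𝟙 ∘ d) ⟩
  sum𝔹 (λ a → sum𝔹 λ h → 𝟙 (d (e , a , h))) + count (d ∘ upPt e)  ≡⟨ cong₂ _+_ at-e elsewhere ⟩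
  1                                                                ∎
  where
  open ≡-Reasoning
  at-e : sum𝔹 (λ a → sum𝔹 λ h → 𝟙 (d (e , a , h))) ≡ 1
  at-e = sum𝔹²-unique (λ a h → d (e , a , h)) ((a₀ , h₀) , dw , λ t → cong proj₂ (unique t))
  false-off-e : ∀ p → d (upPt e p) ≡ false
  false-off-e p@(i , _) with d (upPt e p) in dp
  ... | false = refl
  ... | true = contradiction (cong proj₁ (unique (subst T (sym dp) _))) (punchInᵢ≢i e i ∘ sym)
  elsewhere : count (d ∘ upPt e) ≡ 0
  elsewhere = trans (S-cong (∑ᴾ-linear n) (cong 𝟙 ∘ false-off-e)) (S-0 (∑ᴾ-linear n))

𝟙-as-count : ∀ {m} b (f : Point m → Bool) → (T b → count f ≡ 1) → 𝟙 b ≡ count (λ y → b ∧ f y)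
𝟙-as-count true f count≡1 = sym (count≡1 _)
𝟙-as-count {m} false f _ = sym (S-0 (∑ᴾ-linear m))

-- Double counting of the pairs (x , y) with P x, Q y and R x y.
count-by-matching : ∀ {m} (P Q : Point m → Bool) (R : Point m → Point m → Bool) →
  (∀ x → T (P x) → ∃! _≡_ (λ y → T (Q y ∧ R x y))) →
  (∀ y → T (Q y) → ∃! _≡_ (λ x → T (P x ∧ R x y))) →
  count P ≡ count Q
count-by-matching {m} P Q R P⇒match Q⇒match = begin
  count P
    ≡⟨ S-cong (∑ᴾ-linear m) (λ x → 𝟙-as-count (P x) (λ y → Q y ∧ R x y) (count-unique _ ∘ P⇒match x)) ⟩
  ∑ᴾ m (λ x → ∑ᴾ m λ y → 𝟙 (P x ∧ (Q y ∧ R x y)))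
    ≡⟨ ∑ᴾ-commute (∑ᴾ-linear m) m (λ x y → 𝟙 (P x ∧ (Q y ∧ R x y))) ⟩
  ∑ᴾ m (λ y → ∑ᴾ m λ x → 𝟙 (P x ∧ (Q y ∧ R x y)))
    ≡⟨ S-cong (∑ᴾ-linear m) (λ y → S-cong (∑ᴾ-linear m) λ x → cong 𝟙 (∧-swap (P x) (Q y) (R x y))) ⟩
  ∑ᴾ m (λ y → ∑ᴾ m λ x → 𝟙 (Q y ∧ (P x ∧ R x y)))
    ≡⟨ S-cong (∑ᴾ-linear m) (λ y → sym (𝟙-as-count (Q y) (λ x → P x ∧ R x y) (count-unique _ ∘ Q⇒match y))) ⟩
  count Q
    ∎
  where
  open ≡-Reasoning
  ∧-swap : ∀ a b c → a ∧ (b ∧ c) ≡ b ∧ (a ∧ c)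
  ∧-swap a b c = trans (sym (Bool.∧-assoc a b c)) (trans (cong (_∧ c) (Bool.∧-comm a b)) (Bool.∧-assoc b a c))

count-reindex : ∀ {m} (P : Point m → Bool) (ψ ψ⁻¹ : Point m → Point m) →
  ψ ∘ ψ⁻¹ ≗ id → ψ⁻¹ ∘ ψ ≗ id → count (P ∘ ψ⁻¹) ≡ count P
count-reindex P ψ ψ⁻¹ ψψ⁻¹ ψ⁻¹ψ = count-by-matching (P ∘ ψ⁻¹) P (λ x y → ⌊ y ≟ᴾ ψ⁻¹ x ⌋)
  (λ x Px → ψ⁻¹ x , T-∧⁺ Px (fromWitness refl) , λ {y} t → sym (toWitness (T-∧ʳ {P y} t)))
  (λ y Py → ψ y , T-∧⁺ (subst (T ∘ P) (sym (ψ⁻¹ψ y)) Py) (fromWitness (sym (ψ⁻¹ψ y)))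
              , λ {x} t → trans (cong ψ (toWitness (T-∧ʳ {P (ψ⁻¹ x)} t))) (ψψ⁻¹ x))

-- The curves of a state s of G are the orbits of the arc matching σ = σ G together with the
-- state pairing π = statePair s; isLeast unfolds to isRep G s for these σ and π.
module Curves {m : ℕ} (σ π : Point m → Point m)
  (σ-invol : ∀ p → σ (σ p) ≡ p) (π-invol : ∀ p → π (π p) ≡ p) where

  open import Data.List.Membership.DecPropositional (_≟ᴾ_ {m}) using (_∈?_)

  infix 4 _⇝_
  data _⇝_ (p : Point m) : Point m → Set where
    here : p ⇝ p
    σ-step : ∀ {q} → p ⇝ q → p ⇝ σ q
    π-step : ∀ {q} → p ⇝ q → p ⇝ π q

  ⇝-trans : ∀ {p q r} → p ⇝ q → q ⇝ r → p ⇝ r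
  ⇝-trans p⇝q here = p⇝q
  ⇝-trans p⇝q (σ-step q⇝r) = σ-step (⇝-trans p⇝q q⇝r)
  ⇝-trans p⇝q (π-step q⇝r) = π-step (⇝-trans p⇝q q⇝r)

  ⇝-sym : ∀ {p q} → p ⇝ q → q ⇝ p
  ⇝-sym here = here
  ⇝-sym (σ-step {q} p⇝q) = ⇝-trans (subst (σ q ⇝_) (σ-invol q) (σ-step here)) (⇝-sym p⇝q)
  ⇝-sym (π-step {q} p⇝q) = ⇝-trans (subst (π q ⇝_) (π-invol q) (π-step here)) (⇝-sym p⇝q)

  step : Point m → Point m
  step q = σ (π q)

  step-injective : ∀ {p q} → step p ≡ step q → p ≡ q
  step-injective {p} {q} eq = begin
    p              ≡⟨ π-invol p ⟨
    π (π p)        ≡⟨ cong π (σ-invol (π p)) ⟨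
    π (σ (step p)) ≡⟨ cong (π ∘ σ) eq ⟩
    π (σ (step q)) ≡⟨ cong π (σ-invol (π q)) ⟩
    π (π q)        ≡⟨ π-invol q ⟩
    q              ∎
    where open ≡-Reasoning

  stepⁿ : ℕ → Point m → Point m
  stepⁿ zero p = p
  stepⁿ (suc k) p = stepⁿ k (step p)

  stepⁿ-suc : ∀ k p → stepⁿ (suc k) p ≡ step (stepⁿ k p)
  stepⁿ-suc zero p = refl
  stepⁿ-suc (suc k) p = stepⁿ-suc k (step p)

  stepⁿ-+ : ∀ i k p → stepⁿ (i + k) p ≡ stepⁿ k (stepⁿ i p)
  stepⁿ-+ zero k p = refl
  stepⁿ-+ (suc i) k p = stepⁿ-+ i k (step p)

  stepⁿ-injective : ∀ i {p q} → stepⁿ i p ≡ stepⁿ i q → p ≡ q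
  stepⁿ-injective zero eq = eq
  stepⁿ-injective (suc i) eq = step-injective (stepⁿ-injective i eq)

  ⇝-stepⁿ : ∀ k p → p ⇝ stepⁿ k p
  ⇝-stepⁿ zero p = here
  ⇝-stepⁿ (suc k) p = subst (p ⇝_) (sym (stepⁿ-suc k p)) (σ-step (π-step (⇝-stepⁿ k p)))

  record Period (p : Point m) : Set where
    field
      d : ℕ
      0<d : 0 < d
      d≤4m : d ≤ 4 * m
      stepᵈ : stepⁿ d p ≡ p

  -- Two of the 4m + 1 points stepⁱ p, i ≤ 4m, coincide; step is injective.
  period : ∀ p → Period p
  period p with pigeonhole (s≤s (≤-reflexive (*-comm m 4))) (λ i → pointIndex (stepⁿ (toℕ i) p))
  ... | i , j , i<j , same = record
    { d = d ; 0<d = m<n⇒0<n∸m i<j ; d≤4m = ≤-trans (m∸n≤m (toℕ j) (toℕ i)) (≤-pred (toℕ<n j)) ; stepᵈ = returns }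
    where
    d = toℕ j ∸ toℕ i
    returns : stepⁿ d p ≡ p
    returns = stepⁿ-injective (toℕ i) (begin
      stepⁿ (toℕ i) (stepⁿ d p)  ≡⟨ stepⁿ-+ d (toℕ i) p ⟨
      stepⁿ (d + toℕ i) p        ≡⟨ cong (λ k → stepⁿ k p) (trans (+-comm d (toℕ i)) (m+[n∸m]≡n (<⇒≤ i<j))) ⟩
      stepⁿ (toℕ j) p            ≡⟨ pointIndex-injective same ⟨
      stepⁿ (toℕ i) p            ∎)
      where open ≡-Reasoning

  stepⁿ-within-period : ∀ {p} (P : Period p) k → ∃[ j ] j < Period.d P × stepⁿ k p ≡ stepⁿ j p
  stepⁿ-within-period P zero = 0 , Period.0<d P , refl
  stepⁿ-within-period {p} P (suc k) with stepⁿ-within-period P k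
  ... | j , j<d , eq with m≤n⇒m<n∨m≡n j<d
  ...   | inj₁ 1+j<d = suc j , 1+j<d , trans (stepⁿ-suc k p) (trans (cong step eq) (sym (stepⁿ-suc j p)))
  ...   | inj₂ 1+j≡d = 0 , Period.0<d P , (begin
    stepⁿ (suc k) p  ≡⟨ stepⁿ-suc k p ⟩
    step (stepⁿ k p) ≡⟨ cong step eq ⟩
    step (stepⁿ j p) ≡⟨ stepⁿ-suc j p ⟨
    stepⁿ (suc j) p  ≡⟨ cong (λ i → stepⁿ i p) 1+j≡d ⟩
    stepⁿ (Period.d P) p ≡⟨ Period.stepᵈ P ⟩
    p                ∎)
    where open ≡-Reasoning

  σ-stepⁿ : ∀ k p → ∃[ j ] σ (stepⁿ k p) ≡ π (stepⁿ j p)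
  σ-stepⁿ (suc k) p = k , trans (cong σ (stepⁿ-suc k p)) (σ-invol _)
  σ-stepⁿ zero p with period p
  ... | record { d = suc d ; stepᵈ = stepᵈ } = d , trans (cong σ (sym stepᵈ)) (proj₂ (σ-stepⁿ (suc d) p))

  OnCurve : Point m → Point m → Set
  OnCurve p q = ∃[ k ] (q ≡ stepⁿ k p ⊎ q ≡ π (stepⁿ k p))

  ⇝⇒OnCurve : ∀ {p q} → p ⇝ q → OnCurve p q
  ⇝⇒OnCurve here = 0 , inj₁ refl
  ⇝⇒OnCurve (π-step p⇝q) with ⇝⇒OnCurve p⇝q
  ... | k , inj₁ refl = k , inj₂ refl
  ... | k , inj₂ refl = k , inj₁ (π-invol _)
  ⇝⇒OnCurve {p} (σ-step p⇝q) with ⇝⇒OnCurve p⇝q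
  ... | k , inj₁ refl = proj₁ (σ-stepⁿ k p) , inj₂ (proj₂ (σ-stepⁿ k p))
  ... | k , inj₂ refl = suc k , inj₁ (sym (stepⁿ-suc k p))

  curvePoints : Point m → List (Point m)
  curvePoints p = concatMap (λ q → q ∷ π q ∷ []) (iterate step (4 * m) p)

  ∈-iterate⁺ : ∀ {j n} p → j < n → stepⁿ j p ∈ iterate step n p
  ∈-iterate⁺ {zero} {suc n} p _ = here refl
  ∈-iterate⁺ {suc j} {suc n} p (s≤s j<n) = there (∈-iterate⁺ (step p) j<n)

  ∈-iterate⇒⇝ : ∀ {n} p {q} → q ∈ iterate step n p → p ⇝ q
  ∈-iterate⇒⇝ {suc n} p (here refl) = here
  ∈-iterate⇒⇝ {suc n} p (there q∈) = ⇝-trans (σ-step (π-step here)) (∈-iterate⇒⇝ (step p) q∈)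

  OnCurve⇒∈curvePoints : ∀ {p q} → OnCurve p q → q ∈ curvePoints p
  OnCurve⇒∈curvePoints {p} (k , on) with stepⁿ-within-period (period p) k
  ... | j , j<d , eq = ∈-concatMap⁺ (λ q → q ∷ π q ∷ [])
    (lose (∈-iterate⁺ p (≤-trans j<d (Period.d≤4m (period p)))) (pair-member on))
    where
    pair-member : ∀ {q} → q ≡ stepⁿ k p ⊎ q ≡ π (stepⁿ k p) → q ∈ stepⁿ j p ∷ π (stepⁿ j p) ∷ []
    pair-member (inj₁ refl) = here eq
    pair-member (inj₂ refl) = there (here (cong π eq))

  ∈curvePoints⇒⇝ : ∀ {p q} → q ∈ curvePoints p → p ⇝ q
  ∈curvePoints⇒⇝ {p} q∈ with find (∈-concatMap⁻ (λ q → q ∷ π q ∷ []) {iterate step (4 * m) p} q∈)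
  ... | x , x∈ , here refl = ∈-iterate⇒⇝ p x∈
  ... | x , x∈ , there (here refl) = π-step (∈-iterate⇒⇝ p x∈)

  ⇝⇒∈curvePoints : ∀ {p q} → p ⇝ q → q ∈ curvePoints p
  ⇝⇒∈curvePoints = OnCurve⇒∈curvePoints ∘ ⇝⇒OnCurve

  _⇝?_ : ∀ p q → Dec (p ⇝ q)
  p ⇝? q = map′ ∈curvePoints⇒⇝ ⇝⇒∈curvePoints (q ∈? curvePoints p)

  isLeast : Point m → Bool
  isLeast p = allᵇ (λ q → code p ≤ᵇ code q) (curvePoints p)

  isLeast⇒least : ∀ {p q} → T (isLeast p) → p ⇝ q → code p ≤ code q
  isLeast⇒least {p} {q} least p⇝q = ≤ᵇ⇒≤ (code p) (code q) (allᵇ⁻ least (⇝⇒∈curvePoints p⇝q))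

  least⇒isLeast : ∀ {p} → (∀ {q} → p ⇝ q → code p ≤ code q) → T (isLeast p)
  least⇒isLeast {p} least = allᵇ⁺ (curvePoints p) (λ q∈ → ≤⇒≤ᵇ (least (∈curvePoints⇒⇝ q∈)))

  record IsTransversal (R : Point m → Bool) : Set where
    field
      meets : ∀ p → ∃[ w ] T (R w) × p ⇝ w
      once : ∀ {w w'} → T (R w) → T (R w') → w ⇝ w' → w ≡ w'
  open IsTransversal

  isLeast-transversal : IsTransversal isLeast
  isLeast-transversal .meets p = w , least⇒isLeast least , p⇝w
    where
    w = argmin code p (curvePoints p)
    p⇝w : p ⇝ w
    p⇝w with argmin-sel code p (curvePoints p)
    ... | inj₁ w≡p = subst (p ⇝_) (sym w≡p) here
    ... | inj₂ w∈ = ∈curvePoints⇒⇝ w∈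
    least : ∀ {q} → w ⇝ q → code w ≤ code q
    least w⇝q = All.lookup (f[argmin]≤f[xs] p (curvePoints p)) (⇝⇒∈curvePoints (⇝-trans p⇝w w⇝q))
  isLeast-transversal .once least least' w⇝w' =
    code-injective (≤-antisym (isLeast⇒least least w⇝w') (isLeast⇒least least' (⇝-sym w⇝w')))

  count-transversal : ∀ {R} → IsTransversal R → count R ≡ count isLeast
  count-transversal {R} R-transversal = count-by-matching R isLeast (λ x y → ⌊ x ⇝? y ⌋) R⇒match least⇒match
    where
    R⇒match : ∀ x → T (R x) → ∃! _≡_ (λ y → T (isLeast y ∧ ⌊ x ⇝? y ⌋))
    R⇒match x _ = let w , least , x⇝w = isLeast-transversal .meets x in
      w , T-∧⁺ least (fromWitness x⇝w) ,
      λ {y} t → isLeast-transversal .once least (T-∧ˡ {isLeast y} t) (⇝-trans (⇝-sym x⇝w) (toWitness (T-∧ʳ {isLeast y} t)))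
    least⇒match : ∀ y → T (isLeast y) → ∃! _≡_ (λ x → T (R x ∧ ⌊ x ⇝? y ⌋))
    least⇒match y _ = let w , Rw , y⇝w = R-transversal .meets y in
      w , T-∧⁺ Rw (fromWitness (⇝-sym y⇝w)) ,
      λ {x} t → R-transversal .once Rw (T-∧ˡ {R x} t) (⇝-trans (⇝-sym y⇝w) (⇝-sym (toWitness (T-∧ʳ {R x} t))))

module _ {m} {ψ ψ⁻¹ : Point m → Point m} (ψψ⁻¹ : ∀ p → ψ (ψ⁻¹ p) ≡ p) (ψ⁻¹ψ : ∀ p → ψ⁻¹ (ψ p) ≡ p) where

  conjugate-involutive : ∀ {f g : Point m → Point m} → (∀ p → g p ≡ ψ (f (ψ⁻¹ p))) →
    (∀ p → f (f p) ≡ p) → ∀ p → g (g p) ≡ p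
  conjugate-involutive {f} {g} g≗ f-invol p = begin
    g (g p)                      ≡⟨ g≗ (g p) ⟩
    ψ (f (ψ⁻¹ (g p)))            ≡⟨ cong (ψ ∘ f ∘ ψ⁻¹) (g≗ p) ⟩
    ψ (f (ψ⁻¹ (ψ (f (ψ⁻¹ p)))))  ≡⟨ cong (ψ ∘ f) (ψ⁻¹ψ _) ⟩
    ψ (f (f (ψ⁻¹ p)))            ≡⟨ cong ψ (f-invol _) ⟩
    ψ (ψ⁻¹ p)                    ≡⟨ ψψ⁻¹ p ⟩
    p                            ∎
    where open ≡-Reasoning

  conjugate-fixedPointFree : ∀ {f g : Point m → Point m} → (∀ p → g p ≡ ψ (f (ψ⁻¹ p))) →
    (∀ p → f p ≢ p) → ∀ p → g p ≢ p
  conjugate-fixedPointFree {f} g≗ f-fpf p gp≡p =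
    f-fpf (ψ⁻¹ p) (trans (sym (ψ⁻¹ψ _)) (cong ψ⁻¹ (trans (sym (g≗ p)) gp≡p)))

  conjugate-sym : ∀ {f g : Point m → Point m} → (∀ p → g p ≡ ψ (f (ψ⁻¹ p))) → ∀ p → f p ≡ ψ⁻¹ (g (ψ p))
  conjugate-sym {f} {g} g≗ p = sym (trans (cong ψ⁻¹ (g≗ (ψ p))) (trans (ψ⁻¹ψ _) (cong f (ψ⁻¹ψ p))))

  Valid-conjugate : ∀ {X K : AP m} → (∀ p → σ K p ≡ ψ (σ X (ψ⁻¹ p))) → Valid X → Valid K
  Valid-conjugate {X} σK≗ (invol , fpf) = conjugate-involutive {σ X} σK≗ invol , conjugate-fixedPointFree {σ X} σK≗ fpf

  module Conjugate {σ₁ π₁ σ₂ π₂ : Point m → Point m}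
    (σ₁-invol : ∀ p → σ₁ (σ₁ p) ≡ p) (π₁-invol : ∀ p → π₁ (π₁ p) ≡ p)
    (σ₂≗ : ∀ p → σ₂ p ≡ ψ (σ₁ (ψ⁻¹ p))) (π₂≗ : ∀ p → π₂ p ≡ ψ (π₁ (ψ⁻¹ p))) where

    module C₁ = Curves σ₁ π₁ σ₁-invol π₁-invol
    module C₂ = Curves σ₂ π₂ (conjugate-involutive {σ₁} σ₂≗ σ₁-invol) (conjugate-involutive {π₁} π₂≗ π₁-invol)

    ⇝₁⇒⇝₂ : ∀ {x y} → x C₁.⇝ y → ψ x C₂.⇝ ψ y
    ⇝₁⇒⇝₂ C₁.here = C₂.here
    ⇝₁⇒⇝₂ (C₁.σ-step {q} x⇝q) = subst (_ C₂.⇝_) (trans (σ₂≗ (ψ q)) (cong (ψ ∘ σ₁) (ψ⁻¹ψ q))) (C₂.σ-step (⇝₁⇒⇝₂ x⇝q))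
    ⇝₁⇒⇝₂ (C₁.π-step {q} x⇝q) = subst (_ C₂.⇝_) (trans (π₂≗ (ψ q)) (cong (ψ ∘ π₁) (ψ⁻¹ψ q))) (C₂.π-step (⇝₁⇒⇝₂ x⇝q))

    ⇝₂⇒⇝₁ : ∀ {x y} → x C₂.⇝ y → ψ⁻¹ x C₁.⇝ ψ⁻¹ y
    ⇝₂⇒⇝₁ C₂.here = C₁.here
    ⇝₂⇒⇝₁ (C₂.σ-step {q} x⇝q) = subst (_ C₁.⇝_) (sym (trans (cong ψ⁻¹ (σ₂≗ q)) (ψ⁻¹ψ _))) (C₁.σ-step (⇝₂⇒⇝₁ x⇝q))
    ⇝₂⇒⇝₁ (C₂.π-step {q} x⇝q) = subst (_ C₁.⇝_) (sym (trans (cong ψ⁻¹ (π₂≗ q)) (ψ⁻¹ψ _))) (C₁.π-step (⇝₂⇒⇝₁ x⇝q))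

    pulled-back-transversal : C₂.IsTransversal (C₁.isLeast ∘ ψ⁻¹)
    pulled-back-transversal .C₂.IsTransversal.meets x =
      let w , least , ψ⁻¹x⇝w = C₁.isLeast-transversal .C₁.IsTransversal.meets (ψ⁻¹ x) in
      ψ w , subst (T ∘ C₁.isLeast) (sym (ψ⁻¹ψ w)) least , subst (C₂._⇝ ψ w) (ψψ⁻¹ x) (⇝₁⇒⇝₂ ψ⁻¹x⇝w)
    pulled-back-transversal .C₂.IsTransversal.once least least' w⇝w' =
      trans (sym (ψψ⁻¹ _)) (trans (cong ψ (C₁.isLeast-transversal .C₁.IsTransversal.once least least' (⇝₂⇒⇝₁ w⇝w'))) (ψψ⁻¹ _))

    count-isLeast-conjugate : count C₂.isLeast ≡ count C₁.isLeast
    count-isLeast-conjugate =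
      trans (sym (C₂.count-transversal pulled-back-transversal)) (count-reindex C₁.isLeast ψ ψ⁻¹ ψψ⁻¹ ψ⁻¹ψ)

-- The curves of X with the black split π at e, whose other vertex states are those of π'.
-- σ' stands for σ (delete X e) and σ'-invol is abstract: both keep the proof terms handed to
-- Curves D folded, without which every with-abstraction below has to normalise them.
module Deletion {n : ℕ} (e : Fin (suc n)) (X : AP (suc n))
  (σ-invol : ∀ p → σ X (σ X p) ≡ p) (σ-fpf : ∀ p → σ X p ≢ p)
  {π : Point (suc n) → Point (suc n)} {π' : Point n → Point n}
  (π'-invol : ∀ p → π' (π' p) ≡ p)
  (π-up : ∀ p → π (upPt e p) ≡ upPt e (π' p))
  (π-e : ∀ a h → π (e , a , h) ≡ (e , a , not h))
  {σ' : Point n → Point n} (σ'-def : ∀ p → σ' p ≡ σ (delete X e) p) where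

  private
    σ₀ : Point (suc n) → Point (suc n)
    σ₀ = σ X
    up : Point n → Point (suc n)
    up = upPt e

  σ-injective : ∀ {p q} → σ₀ p ≡ σ₀ q → p ≡ q
  σ-injective {p} {q} eq = trans (sym (σ-invol p)) (trans (cong σ₀ eq) (σ-invol q))

  σ-flip : ∀ {p q} → σ₀ p ≡ q → σ₀ q ≡ p
  σ-flip {p} eq = trans (cong σ₀ (sym eq)) (σ-invol p)

  π-invol : ∀ q → π (π q) ≡ q
  π-invol q with edgeView e q
  ... | on-e a h = trans (cong π (π-e a h)) (trans (π-e a (not h)) (cong (λ h → e , a , h) (not-involutive h)))
  ... | off-e p = trans (cong π (π-up p)) (trans (π-up (π' p)) (cong up (π'-invol p)))

  pass : Point (suc n) → Point (suc n)
  pass = passThrough X e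

  pass-up : ∀ p → pass (up p) ≡ up p
  pass-up p rewrite isEdge-upPt e p = refl

  pass-e : ∀ a h → pass (e , a , h) ≡ σ₀ (e , a , not h)
  pass-e a h rewrite isEdge-self e a h = refl

  -- The walk from up p to up (σ' p): along σ, through at most two arrows of e.
  data Exit (p : Point n) : Point n → Set where
    exit₁ : ∀ {q} → σ₀ (up p) ≡ up q → Exit p q
    exit₂ : ∀ {a h q} → σ₀ (up p) ≡ (e , a , h) → σ₀ (e , a , not h) ≡ up q → Exit p q
    exit₃ : ∀ {a h a' h' q} → σ₀ (up p) ≡ (e , a , h) → σ₀ (e , a , not h) ≡ (e , a' , h') →
            σ₀ (e , a' , not h') ≡ up q → Exit p q

  Exit⇒σ' : ∀ {p q} → Exit p q → σ' p ≡ q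
  Exit⇒σ' {p} {q} ex = trans (σ'-def p) (trans (cong (fromMaybe p ∘ downPt e) (passes ex)) (cong (fromMaybe p) (downPt-upPt e q)))
    where
    passes : ∀ {q} → Exit p q → pass (pass (σ₀ (up p))) ≡ up q
    passes (exit₁ {q} eq₁) = trans (cong (pass ∘ pass) eq₁) (trans (cong pass (pass-up q)) (pass-up q))
    passes (exit₂ {a} {h} {q} eq₁ eq₂) =
      trans (cong (pass ∘ pass) eq₁) (trans (cong pass (trans (pass-e a h) eq₂)) (pass-up q))
    passes (exit₃ {a} {h} {a'} {h'} eq₁ eq₂ eq₃) =
      trans (cong (pass ∘ pass) eq₁) (trans (cong pass (trans (pass-e a h) eq₂)) (trans (pass-e a' h') eq₃))

  -- A third arrow end would be a fifth end of e: σ already pairs (e , a , h) with up p and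
  -- (e , a , not h) with (e , a' , h'), and a' ≠ a.
  no-third-end : ∀ {p a h a' h' a'' h''} → σ₀ (up p) ≡ (e , a , h) → σ₀ (e , a , not h) ≡ (e , a' , h') →
    σ₀ (e , a' , not h') ≢ (e , a'' , h'')
  no-third-end {p} {a} {h} {a'} {h'} {a''} {h''} eq₁ eq₂ eq₃ with ≡-or-≡-not a' a
  ... | inj₁ refl with ≡-or-≡-not h' h
  ...   | inj₁ refl = e≢upPt e p (trans (sym (σ-flip eq₂)) (σ-flip eq₁))
  ...   | inj₂ refl = σ-fpf _ eq₂
  no-third-end {p} {a} {h} {a'} {h'} {a''} {h''} eq₁ eq₂ eq₃ | inj₂ refl with ≡-or-≡-not a'' a
  ... | inj₁ refl with ≡-or-≡-not h'' h
  ...   | inj₁ refl = e≢upPt e p (trans (sym (σ-flip eq₃)) (σ-flip eq₁))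
  ...   | inj₂ refl = not-¬ refl (cong (proj₂ ∘ proj₂) (trans (sym eq₂) (σ-flip eq₃)))
  no-third-end {p} {a} {h} {a'} {h'} {a''} {h''} eq₁ eq₂ eq₃ | inj₂ refl | inj₂ refl with ≡-or-≡-not h'' h'
  ... | inj₁ refl = not-¬ refl (cong (proj₁ ∘ proj₂) (trans (sym (σ-flip eq₂)) (σ-flip eq₃)))
  ... | inj₂ refl = σ-fpf _ eq₃

  Exit-exists : ∀ p → ∃ (Exit p)
  Exit-exists p with σ₀ (up p) in eq₁ | edgeView e (σ₀ (up p))
  ... | _ | off-e q = q , exit₁ eq₁
  ... | _ | on-e a h with σ₀ (e , a , not h) in eq₂ | edgeView e (σ₀ (e , a , not h))
  ...   | _ | off-e q = q , exit₂ eq₁ eq₂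
  ...   | _ | on-e a' h' with σ₀ (e , a' , not h') in eq₃ | edgeView e (σ₀ (e , a' , not h'))
  ...     | _ | off-e q = q , exit₃ eq₁ eq₂ eq₃
  ...     | _ | on-e a'' h'' = contradiction eq₃ (no-third-end eq₁ eq₂)

  exit : ∀ p → Exit p (σ' p)
  exit p = let q , ex = Exit-exists p in subst (Exit p) (sym (Exit⇒σ' ex)) ex

  Exit-reverse : ∀ {p q} → Exit p q → Exit q p
  Exit-reverse (exit₁ eq₁) = exit₁ (σ-flip eq₁)
  Exit-reverse {p} (exit₂ {a} {h} eq₁ eq₂) =
    exit₂ (σ-flip eq₂) (subst (λ h → σ₀ (e , a , h) ≡ up p) (sym (not-involutive h)) (σ-flip eq₁))
  Exit-reverse {p} (exit₃ {a} {h} {a'} {h'} eq₁ eq₂ eq₃) =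
    exit₃ (σ-flip eq₃) (subst (λ h′ → σ₀ (e , a' , h′) ≡ (e , a , not h)) (sym (not-involutive h')) (σ-flip eq₂))
          (subst (λ h → σ₀ (e , a , h) ≡ up p) (sym (not-involutive h)) (σ-flip eq₁))

  abstract
    σ'-invol : ∀ p → σ' (σ' p) ≡ p
    σ'-invol p = Exit⇒σ' (Exit-reverse (exit p))

  module G = Curves σ₀ π σ-invol π-invol
  module D = Curves σ' π' σ'-invol π'-invol

  _σ⟶_ : ∀ {x y z} → x G.⇝ y → σ₀ y ≡ z → x G.⇝ z
  x⇝y σ⟶ refl = G.σ-step x⇝y

  _π⟶_ : ∀ {x y z} → x G.⇝ y → π y ≡ z → x G.⇝ z
  x⇝y π⟶ refl = G.π-step x⇝y

  infixl 5 _σ⟶_ _π⟶_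

  Exit⇒⇝ : ∀ {p q} → Exit p q → up p G.⇝ up q
  Exit⇒⇝ (exit₁ eq₁) = G.here σ⟶ eq₁
  Exit⇒⇝ (exit₂ {a} {h} eq₁ eq₂) = G.here σ⟶ eq₁ π⟶ π-e a h σ⟶ eq₂
  Exit⇒⇝ (exit₃ {a} {h} {a'} {h'} eq₁ eq₂ eq₃) = G.here σ⟶ eq₁ π⟶ π-e a h σ⟶ eq₂ π⟶ π-e a' h' σ⟶ eq₃

  ⇝ᴰ⇒⇝ᴳ : ∀ {p q} → p D.⇝ q → up p G.⇝ up q
  ⇝ᴰ⇒⇝ᴳ D.here = G.here
  ⇝ᴰ⇒⇝ᴳ (D.σ-step {q} p⇝q) = G.⇝-trans (⇝ᴰ⇒⇝ᴳ p⇝q) (Exit⇒⇝ (exit q))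
  ⇝ᴰ⇒⇝ᴳ (D.π-step {q} p⇝q) = ⇝ᴰ⇒⇝ᴳ p⇝q π⟶ π-up q

  data Visited (p : Point n) : Point (suc n) → Set where
    start : Visited p (up p)
    first-arrow : ∀ {a h} → σ₀ (up p) ≡ (e , a , h) → ∀ h₁ → Visited p (e , a , h₁)
    second-arrow : ∀ {a h a' h'} → σ₀ (up p) ≡ (e , a , h) → σ₀ (e , a , not h) ≡ (e , a' , h') →
                   ∀ h₁ → Visited p (e , a' , h₁)

  Covered : Point n → Point (suc n) → Set
  Covered p₀ q = ∃[ p ] p₀ D.⇝ p × Visited p q

  covered-π : ∀ {p₀ q} → Covered p₀ q → Covered p₀ (π q)
  covered-π (p , r , start) = π' p , D.π-step r , subst (Visited _) (sym (π-up p)) start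
  covered-π (p , r , first-arrow {a} eq₁ h₁) = p , r , subst (Visited p) (sym (π-e a h₁)) (first-arrow eq₁ (not h₁))
  covered-π (p , r , second-arrow {a' = a'} eq₁ eq₂ h₁) =
    p , r , subst (Visited p) (sym (π-e a' h₁)) (second-arrow eq₁ eq₂ (not h₁))

  σ-leaving : ∀ {p₀ p q} → p₀ D.⇝ p → p₀ D.⇝ q → Exit p q → Covered p₀ (σ₀ (up p))
  σ-leaving {q = q} _ r′ (exit₁ eq₁) = q , r′ , subst (Visited q) (sym eq₁) start
  σ-leaving {p = p} r _ (exit₂ {h = h} eq₁ _) = p , r , subst (Visited p) (sym eq₁) (first-arrow eq₁ h)
  σ-leaving {p = p} r _ (exit₃ {h = h} eq₁ _ _) = p , r , subst (Visited p) (sym eq₁) (first-arrow eq₁ h)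

  σ-after-first : ∀ {p₀ p q a h} → p₀ D.⇝ p → p₀ D.⇝ q → σ₀ (up p) ≡ (e , a , h) → Exit p q →
    Covered p₀ (σ₀ (e , a , not h))
  σ-after-first _ _ eq₁ (exit₁ eq₁′) = contradiction (trans (sym eq₁) eq₁′) (e≢upPt e _)
  σ-after-first {q = q} _ r′ eq₁ (exit₂ eq₁′ eq₂) with refl ← trans (sym eq₁) eq₁′ =
    q , r′ , subst (Visited q) (sym eq₂) start
  σ-after-first {p = p} r _ eq₁ (exit₃ {h' = h'} eq₁′ eq₂ _) with refl ← trans (sym eq₁) eq₁′ =
    p , r , subst (Visited p) (sym eq₂) (second-arrow eq₁ eq₂ h')

  σ-after-second : ∀ {p₀ p q a h a' h'} → p₀ D.⇝ q → σ₀ (up p) ≡ (e , a , h) →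
    σ₀ (e , a , not h) ≡ (e , a' , h') → Exit p q → Covered p₀ (σ₀ (e , a' , not h'))
  σ-after-second _ eq₁ _ (exit₁ eq₁′) = contradiction (trans (sym eq₁) eq₁′) (e≢upPt e _)
  σ-after-second _ eq₁ eq₂ (exit₂ eq₁′ eq₂′) with refl ← trans (sym eq₁) eq₁′ =
    contradiction (trans (sym eq₂) eq₂′) (e≢upPt e _)
  σ-after-second {q = q} r′ eq₁ eq₂ (exit₃ eq₁′ eq₂′ eq₃) with refl ← trans (sym eq₁) eq₁′ with refl ← trans (sym eq₂) eq₂′ =
    q , r′ , subst (Visited q) (sym eq₃) start

  covered-σ : ∀ {p₀ q} → Covered p₀ q → Covered p₀ (σ₀ q)
  covered-σ (p , r , start) = σ-leaving r (D.σ-step r) (exit p)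
  covered-σ (p , r , first-arrow {a} {h} eq₁ h₁) with ≡-or-≡-not h₁ h
  ... | inj₁ refl = p , r , subst (Visited p) (sym (σ-flip eq₁)) start
  ... | inj₂ refl = σ-after-first r (D.σ-step r) eq₁ (exit p)
  covered-σ (p , r , second-arrow {a} {h} {a'} {h'} eq₁ eq₂ h₁) with ≡-or-≡-not h₁ h'
  ... | inj₁ refl = p , r , subst (Visited p) (sym (σ-flip eq₂)) (first-arrow eq₁ (not h))
  ... | inj₂ refl = σ-after-second (D.σ-step r) eq₁ eq₂ (exit p)

  covered : ∀ {p₀ q} → up p₀ G.⇝ q → Covered p₀ q
  covered G.here = _ , D.here , start
  covered (G.σ-step r) = covered-σ (covered r)
  covered (G.π-step r) = covered-π (covered r)

  ⇝ᴳ⇒⇝ᴰ : ∀ {p q} → up p G.⇝ up q → p D.⇝ q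
  ⇝ᴳ⇒⇝ᴰ {p} r = let p' , r' , v = covered r in subst (p D.⇝_) (visited-up v refl) r'
    where
    visited-up : ∀ {p q x} → Visited p x → x ≡ up q → p ≡ q
    visited-up start eq = upPt-injective e eq
    visited-up (first-arrow _ _) eq = contradiction eq (e≢upPt e _)
    visited-up (second-arrow _ _ _) eq = contradiction eq (e≢upPt e _)

  OnE : Point (suc n) → Set
  OnE q = isEdge e q ≡ true

  up-not-OnE : ∀ p → ¬ OnE (up p)
  up-not-OnE p onE = contradiction (trans (sym onE) (isEdge-upPt e p)) λ ()

  OnE⇒e : ∀ {q} → OnE q → ∃₂ λ a h → q ≡ (e , a , h)
  OnE⇒e {q} onE with edgeView e q
  ... | on-e a h = a , h , refl
  ... | off-e p = contradiction onE (up-not-OnE p)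

  meets-off-e? : ∀ x → (∃[ p ] x G.⇝ up p) ⊎ (∀ {q} → x G.⇝ q → OnE q)
  meets-off-e? x with any? (λ q → isEdge e q Bool.≟ false) (G.curvePoints x)
  ... | yes off with find off
  ...   | q , q∈ , offE with edgeView e q
  ...     | on-e a h = contradiction (trans (sym (isEdge-self e a h)) offE) λ ()
  ...     | off-e p = inj₁ (p , G.∈curvePoints⇒⇝ q∈)
  meets-off-e? x | no none = inj₂ λ x⇝q → ¬-not (λ offE → none (lose (G.⇝⇒∈curvePoints x⇝q) offE))

  tA hA tB hB : Point (suc n)
  tA = e , false , false
  hA = e , false , true
  tB = e , true , false
  hB = e , true , true

  inB : Point (suc n) → Bool
  inB (x , a , h) = isEdge e (x , a , h) ∧ a

  loopA loopB fourCycle : Bool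
  loopA = σ₀ tA == hA
  loopB = σ₀ tB == hB
  fourCycle = inB (σ₀ hA) ∧ inB (σ₀ tA)

  -- One end on each curve made of ends of e only: {tA , hA} if σ tA ≡ hA, {tB , hB} if
  -- σ tB ≡ hB, and all four ends if σ matches the ends of A with those of B. These are the
  -- circles counted by onlyECircles.
  cornerRep : Bool → Bool → Bool
  cornerRep false false = loopA ∨ fourCycle
  cornerRep true false = loopB
  cornerRep _ true = false

  repᴳ : Point (suc n) → Bool
  repᴳ q = maybe′ D.isLeast (cornerRep (proj₁ (proj₂ q)) (proj₂ (proj₂ q))) (downPt e q)

  repᴳ-up : ∀ p → repᴳ (up p) ≡ D.isLeast p
  repᴳ-up p = cong (maybe′ D.isLeast _) (downPt-upPt e p)

  repᴳ-e : ∀ a h → repᴳ (e , a , h) ≡ cornerRep a h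
  repᴳ-e a h = cong (maybe′ D.isLeast _) (downPt-self e a h)

  e-OnE : ∀ a h → OnE (e , a , h)
  e-OnE = isEdge-self e

  loop-closed : ∀ a → σ₀ (e , a , false) ≡ (e , a , true) →
    ∀ {q} → (e , a , false) G.⇝ q → q ≡ (e , a , false) ⊎ q ≡ (e , a , true)
  loop-closed a loop G.here = inj₁ refl
  loop-closed a loop (G.σ-step r) with loop-closed a loop r
  ... | inj₁ refl = inj₂ loop
  ... | inj₂ refl = inj₁ (σ-flip loop)
  loop-closed a loop (G.π-step r) with loop-closed a loop r
  ... | inj₁ refl = inj₂ (π-e a false)
  ... | inj₂ refl = inj₁ (π-e a true)

  loop-OnE : ∀ a → σ₀ (e , a , false) ≡ (e , a , true) → ∀ {q} → (e , a , false) G.⇝ q → OnE q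
  loop-OnE a loop r with loop-closed a loop r
  ... | inj₁ refl = e-OnE a false
  ... | inj₂ refl = e-OnE a true

  inB⇒B : ∀ {q} → T (inB q) → ∃[ h ] q ≡ (e , true , h)
  inB⇒B {q} t with OnE⇒e {q} (Equivalence.to Bool.T-≡ (T-∧ˡ {isEdge e q} t))
  ... | true , h , refl = h , refl
  ... | false , h , refl = contradiction (T-∧ʳ {isEdge e q} t) id

  fourCycle-σ-OnE : T fourCycle → ∀ a h → OnE (σ₀ (e , a , h))
  fourCycle-σ-OnE t with inB⇒B {σ₀ hA} (T-∧ˡ {inB (σ₀ hA)} t) | inB⇒B {σ₀ tA} (T-∧ʳ {inB (σ₀ hA)} t)
  ... | h₂ , σhA | h₁ , σtA = on
    where
    on : ∀ a h → OnE (σ₀ (e , a , h))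
    on false false = subst OnE (sym σtA) (e-OnE true h₁)
    on false true = subst OnE (sym σhA) (e-OnE true h₂)
    on true h with ≡-or-≡-not h h₁ | ≡-or-≡-not h₂ h₁
    ... | inj₁ refl | _ = subst OnE (sym (σ-flip σtA)) (e-OnE false false)
    ... | inj₂ refl | inj₁ refl = contradiction (σ-injective (trans σtA (sym σhA))) λ ()
    ... | inj₂ refl | inj₂ refl = subst OnE (sym (σ-flip σhA)) (e-OnE false true)

  σ-OnE-closed : (∀ a h → OnE (σ₀ (e , a , h))) → ∀ {x q} → OnE x → x G.⇝ q → OnE q
  σ-OnE-closed σ-on x-on G.here = x-on
  σ-OnE-closed σ-on x-on (G.σ-step r) with OnE⇒e (σ-OnE-closed σ-on x-on r)
  ... | a , h , refl = σ-on a h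
  σ-OnE-closed σ-on x-on (G.π-step r) with OnE⇒e (σ-OnE-closed σ-on x-on r)
  ... | a , h , refl = subst OnE (sym (π-e a h)) (e-OnE a (not h))

  cornerRep-OnE : ∀ a h → T (cornerRep a h) → ∀ {q} → (e , a , h) G.⇝ q → OnE q
  cornerRep-OnE false false t with Equivalence.to Bool.T-∨ t
  ... | inj₁ loop = loop-OnE false (==⇒≡ loop)
  ... | inj₂ four = σ-OnE-closed (fourCycle-σ-OnE four) (e-OnE false false)
  cornerRep-OnE true false loop = loop-OnE true (==⇒≡ loop)

  AllOnE : Point (suc n) → Set
  AllOnE x = ∀ {q} → x G.⇝ q → OnE q

  inB-B : ∀ h → T (inB (e , true , h))
  inB-B h = Equivalence.from Bool.T-≡ (cong (_∧ true) (isEdge-self e true h))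

  AllOnE-tA⇒cornerRep : AllOnE tA → T (cornerRep false false)
  AllOnE-tA⇒cornerRep allE with OnE⇒e (allE (G.σ-step G.here))
  ... | false , false , σtA = contradiction σtA (σ-fpf tA)
  ... | false , true , σtA = T-∨ˡ (subst (λ q → T (q == hA)) (sym σtA) (==-refl hA))
  ... | true , h₁ , σtA with OnE⇒e (allE (G.σ-step (G.here π⟶ π-e false false)))
  ...   | false , false , σhA = contradiction (trans (sym σtA) (σ-flip σhA)) λ ()
  ...   | false , true , σhA = contradiction σhA (σ-fpf hA)
  ...   | true , h₂ , σhA = T-∨ʳ {loopA} (subst T (sym (cong₂ (λ x y → inB x ∧ inB y) σhA σtA)) (T-∧⁺ (inB-B h₂) (inB-B h₁)))

  AllOnE-tB⇒ : AllOnE tB → T loopB ⊎ tB G.⇝ tA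
  AllOnE-tB⇒ allE with OnE⇒e (allE (G.σ-step G.here))
  ... | true , false , σtB = contradiction σtB (σ-fpf tB)
  ... | true , true , σtB = inj₁ (subst (λ q → T (q == hB)) (sym σtB) (==-refl hB))
  ... | false , false , σtB = inj₂ (G.here σ⟶ σtB)
  ... | false , true , σtB = inj₂ (G.here σ⟶ σtB π⟶ π-e false true)

  AllOnE⇒meets : ∀ {x} → AllOnE x → ∃[ w ] T (repᴳ w) × x G.⇝ w
  AllOnE⇒meets {x} allE = go (edgeView e x) allE
    where
    to-tail : ∀ a h → (e , a , h) G.⇝ (e , a , false)
    to-tail a false = G.here
    to-tail a true = G.here π⟶ π-e a true
    via-tA : ∀ {x} → AllOnE x → x G.⇝ tA → ∃[ w ] T (repᴳ w) × x G.⇝ w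
    via-tA allE x⇝tA = tA , subst T (sym (repᴳ-e false false)) (AllOnE-tA⇒cornerRep (allE ∘ G.⇝-trans x⇝tA)) , x⇝tA
    go : ∀ {x} → EdgeView e x → AllOnE x → ∃[ w ] T (repᴳ w) × x G.⇝ w
    go (off-e p) allE = contradiction (allE G.here) (up-not-OnE p)
    go (on-e false h) allE = via-tA allE (to-tail false h)
    go (on-e true h) allE with AllOnE-tB⇒ (allE ∘ G.⇝-trans (to-tail true h))
    ... | inj₁ loop = tB , subst T (sym (repᴳ-e true false)) loop , to-tail true h
    ... | inj₂ tB⇝tA = via-tA allE (G.⇝-trans (to-tail true h) tB⇝tA)

  repᴳ-transversal : G.IsTransversal repᴳ
  repᴳ-transversal .G.IsTransversal.meets x with meets-off-e? x
  ... | inj₂ allE = AllOnE⇒meets allE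
  ... | inj₁ (p , x⇝up) = let w , least , p⇝w = D.isLeast-transversal .D.IsTransversal.meets p in
        up w , subst T (sym (repᴳ-up w)) least , G.⇝-trans x⇝up (⇝ᴰ⇒⇝ᴳ p⇝w)
  repᴳ-transversal .G.IsTransversal.once {w} {w'} = once-view (edgeView e w) (edgeView e w')
    where
    cornerReps-once : ∀ a h a' h' → T (cornerRep a h) → T (cornerRep a' h') → (e , a , h) G.⇝ (e , a' , h') →
      (e , a , h) ≡ (e , a' , h')
    cornerReps-once false false false false _ _ _ = refl
    cornerReps-once true false true false _ _ _ = refl
    cornerReps-once false false true false _ loop r with loop-closed true (==⇒≡ loop) (G.⇝-sym r)
    ... | inj₁ ()
    ... | inj₂ ()
    cornerReps-once true false false false loop _ r with loop-closed true (==⇒≡ loop) r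
    ... | inj₁ ()
    ... | inj₂ ()
    once-view : ∀ {w w'} → EdgeView e w → EdgeView e w' → T (repᴳ w) → T (repᴳ w') → w G.⇝ w' → w ≡ w'
    once-view (off-e p) (off-e p') t t' r =
      cong up (D.isLeast-transversal .D.IsTransversal.once (subst T (repᴳ-up p) t) (subst T (repᴳ-up p') t') (⇝ᴳ⇒⇝ᴰ r))
    once-view (on-e a h) (off-e p') t _ r = contradiction (cornerRep-OnE a h (subst T (repᴳ-e a h) t) r) (up-not-OnE p')
    once-view (off-e p) (on-e a h) _ t' r = contradiction (cornerRep-OnE a h (subst T (repᴳ-e a h) t') (G.⇝-sym r)) (up-not-OnE p)
    once-view (on-e a h) (on-e a' h') t t' r = cornerReps-once a h a' h' (subst T (repᴳ-e a h) t) (subst T (repᴳ-e a' h') t') r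

  loopA-fourCycle-exclusive : ¬ (T loopA × T fourCycle)
  loopA-fourCycle-exclusive (loop , four) with inB⇒B {σ₀ tA} (T-∧ʳ {inB (σ₀ hA)} four)
  ... | _ , σtA = contradiction (trans (sym (==⇒≡ {p = σ₀ tA} {hA} loop)) σtA) λ ()

  corner-count : sum𝔹 (λ a → sum𝔹 λ h → 𝟙 (repᴳ (e , a , h))) ≡ onlyECircles X e
  corner-count = begin
    sum𝔹 (λ a → sum𝔹 λ h → 𝟙 (repᴳ (e , a , h)))   ≡⟨ S-cong sum𝔹-linear (λ a → S-cong sum𝔹-linear λ h → cong 𝟙 (repᴳ-e a h)) ⟩
    𝟙 loopB + 𝟙 (loopA ∨ fourCycle)                 ≡⟨ cong (𝟙 loopB +_) (𝟙-∨ loopA-fourCycle-exclusive) ⟩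
    𝟙 loopB + (𝟙 loopA + 𝟙 fourCycle)               ≡⟨ +-assoc (𝟙 loopB) _ _ ⟨
    𝟙 loopB + 𝟙 loopA + 𝟙 fourCycle                 ≡⟨ cong (_+ 𝟙 fourCycle) (+-comm (𝟙 loopB) (𝟙 loopA)) ⟩
    𝟙 loopA + 𝟙 loopB + 𝟙 fourCycle                 ∎
    where open ≡-Reasoning

  count-isLeast-deletion : count G.isLeast ≡ onlyECircles X e + count D.isLeast
  count-isLeast-deletion = begin
    count G.isLeast                                           ≡⟨ G.count-transversal repᴳ-transversal ⟨
    count repᴳ                                                ≡⟨ ∑ᴾ-remove e (𝟙 ∘ repᴳ) ⟩
    sum𝔹 (λ a → sum𝔹 λ h → 𝟙 (repᴳ (e , a , h))) + count (repᴳ ∘ up)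
      ≡⟨ cong₂ _+_ corner-count (S-cong (∑ᴾ-linear n) (cong 𝟙 ∘ repᴳ-up)) ⟩
    onlyECircles X e + count D.isLeast                        ∎
    where open ≡-Reasoning

numCurves-count : ∀ {m} (G : AP m) (s : Vec Bool m) → numCurves G s ≡ iso G + count (isRep G s)
numCurves-count G s = cong (iso G +_) (length-filterᵇ-allPoints (isRep G s))

numCross-insertAt : ∀ {n} (s : Vec Bool n) e b → numCross (insertAt s e b) ≡ 𝟙 b + numCross s
numCross-insertAt s zero true = refl
numCross-insertAt s zero false = refl
numCross-insertAt (true ∷ s) (suc e) b = trans (cong suc (numCross-insertAt s e b)) (sym (+-suc (𝟙 b) _))
numCross-insertAt (false ∷ s) (suc e) b = numCross-insertAt s e b

sumℤ-map-+ : ∀ {A : Set} (f g : A → ℤ) xs → sumℤ (map (λ x → f x ℤ.+ g x) xs) ≡ sumℤ (map f xs) ℤ.+ sumℤ (map g xs)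
sumℤ-map-+ f g [] = refl
sumℤ-map-+ f g (x ∷ xs) = trans (cong (ℤ._+_ (f x ℤ.+ g x)) (sumℤ-map-+ f g xs)) (interchange ℤ.+-commutativeSemigroup (f x) (g x) _ _)

sumℤ-map-neg : ∀ {A : Set} (f : A → ℤ) xs → sumℤ (map (λ x → ℤ.- f x) xs) ≡ ℤ.- sumℤ (map f xs)
sumℤ-map-neg f [] = refl
sumℤ-map-neg f (x ∷ xs) = trans (cong (ℤ._+_ (ℤ.- f x)) (sumℤ-map-neg f xs)) (sym (ℤ.neg-distrib-+ (f x) _))

sumℤ-allStates-insertAt : ∀ n (e : Fin (suc n)) (h : Vec Bool (suc n) → ℤ) →
  sumℤ (map h (allStates (suc n))) ≡ sumℤ (map (λ s → h (insertAt s e true) ℤ.+ h (insertAt s e false)) (allStates n))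
sumℤ-allStates-insertAt n zero h = head-pairs (allStates n)
  where
  head-pairs : ∀ ss → sumℤ (map h (concatMap (λ s → (true ∷ s) ∷ (false ∷ s) ∷ []) ss))
                     ≡ sumℤ (map (λ s → h (true ∷ s) ℤ.+ h (false ∷ s)) ss)
  head-pairs [] = refl
  head-pairs (s ∷ ss) = trans (sym (ℤ.+-assoc (h (true ∷ s)) (h (false ∷ s)) _)) (cong (ℤ._+_ (h (true ∷ s) ℤ.+ h (false ∷ s))) (head-pairs ss))
sumℤ-allStates-insertAt (suc n) (suc e) h = begin
  sumℤ (map h (allStates (suc (suc n))))
    ≡⟨ sumℤ-allStates-insertAt (suc n) zero h ⟩
  sumℤ (map (λ s → h (true ∷ s) ℤ.+ h (false ∷ s)) (allStates (suc n)))
    ≡⟨ sumℤ-map-+ (h ∘ (true ∷_)) (h ∘ (false ∷_)) (allStates (suc n)) ⟩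
  sumℤ (map (h ∘ (true ∷_)) (allStates (suc n))) ℤ.+ sumℤ (map (h ∘ (false ∷_)) (allStates (suc n)))
    ≡⟨ cong₂ ℤ._+_ (sumℤ-allStates-insertAt n e (h ∘ (true ∷_))) (sumℤ-allStates-insertAt n e (h ∘ (false ∷_))) ⟩
  sumℤ (map (λ s → h (true ∷ insertAt s e true) ℤ.+ h (true ∷ insertAt s e false)) (allStates n)) ℤ.+
  sumℤ (map (λ s → h (false ∷ insertAt s e true) ℤ.+ h (false ∷ insertAt s e false)) (allStates n))
    ≡⟨ sumℤ-map-+ _ _ (allStates n) ⟨
  sumℤ (map (λ s → (h (true ∷ insertAt s e true) ℤ.+ h (true ∷ insertAt s e false)) ℤ.+
                   (h (false ∷ insertAt s e true) ℤ.+ h (false ∷ insertAt s e false))) (allStates n))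
    ≡⟨ sumℤ-allStates-insertAt n zero (λ s → h (insertAt s (suc e) true) ℤ.+ h (insertAt s (suc e) false)) ⟨
  sumℤ (map (λ s → h (insertAt s (suc e) true) ℤ.+ h (insertAt s (suc e) false)) (allStates (suc n))) ∎
  where open ≡-Reasoning

contribution : ∀ {m} → AP m → ℕ → Vec Bool m → ℤ
contribution G k s = if numCurves G s ≡ᵇ k then (ℤ.-1ℤ ℤ.^ numCross s) else ℤ.0ℤ

penroseCoeff-split : ∀ {n} (e : Fin (suc n)) (K : AP (suc n)) (A B : AP n) →
  (∀ s → numCurves K (insertAt s e false) ≡ numCurves A s) →
  (∀ s → numCurves K (insertAt s e true) ≡ numCurves B s) →
  ∀ k → penroseCoeff K k ≡ (penroseCoeff A −P penroseCoeff B) k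
penroseCoeff-split {n} e K A B white crossing k = begin
  sumℤ (map (contribution K k) (allStates (suc n)))
    ≡⟨ sumℤ-allStates-insertAt n e (contribution K k) ⟩
  sumℤ (map (λ s → contribution K k (insertAt s e true) ℤ.+ contribution K k (insertAt s e false)) (allStates n))
    ≡⟨ cong sumℤ (map-cong split-at-e (allStates n)) ⟩
  sumℤ (map (λ s → ℤ.- contribution B k s ℤ.+ contribution A k s) (allStates n))
    ≡⟨ sumℤ-map-+ (λ s → ℤ.- contribution B k s) (contribution A k) (allStates n) ⟩
  sumℤ (map (λ s → ℤ.- contribution B k s) (allStates n)) ℤ.+ penroseCoeff A k
    ≡⟨ cong (ℤ._+ penroseCoeff A k) (sumℤ-map-neg (contribution B k) (allStates n)) ⟩
  ℤ.- penroseCoeff B k ℤ.+ penroseCoeff A k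
    ≡⟨ ℤ.+-comm (ℤ.- penroseCoeff B k) (penroseCoeff A k) ⟩
  penroseCoeff A k ℤ.- penroseCoeff B k ∎
  where
  open ≡-Reasoning
  split-at-e : ∀ s → contribution K k (insertAt s e true) ℤ.+ contribution K k (insertAt s e false)
                   ≡ ℤ.- contribution B k s ℤ.+ contribution A k s
  split-at-e s rewrite crossing s | white s | numCross-insertAt s e true | numCross-insertAt s e false
    with numCurves B s ≡ᵇ k
  ... | true = cong (ℤ._+ contribution A k s) (ℤ.-1*i≡-i (ℤ.-1ℤ ℤ.^ numCross s))
  ... | false = refl

record IsLocal {n} (e : Fin (suc n)) (M : Point (suc n) → Point (suc n)) (f : Corner → Corner) : Set where
  field
    fixes-up : ∀ p → M (upPt e p) ≡ upPt e p
    acts-on-e : ∀ a h → M (e , a , h) ≡ (e , f (a , h))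
open IsLocal

module _ {n} {e : Fin (suc n)} where

  IsLocal-∘ : ∀ {M M' f f'} → IsLocal e M f → IsLocal e M' f' → IsLocal e (M ∘ M') (f ∘ f')
  IsLocal-∘ {M} L L' .fixes-up p = trans (cong M (L' .fixes-up p)) (L .fixes-up p)
  IsLocal-∘ {M} L L' .acts-on-e a h = trans (cong M (L' .acts-on-e a h)) (L .acts-on-e _ _)

  IsLocal⇒≗id : ∀ {M f} → IsLocal e M f → (∀ c → f c ≡ c) → ∀ p → M p ≡ p
  IsLocal⇒≗id L f≗id p with edgeView e p
  ... | on-e a h = trans (L .acts-on-e a h) (cong (e ,_) (f≗id (a , h)))
  ... | off-e q = L .fixes-up q

  IsLocal-inverse : ∀ {M M' f f'} → IsLocal e M f → IsLocal e M' f' → (∀ c → f (f' c) ≡ c) → ∀ p → M (M' p) ≡ p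
  IsLocal-inverse L L' ff' = IsLocal⇒≗id (IsLocal-∘ L L') ff'

twist𝔹 dualTo𝔹 dualFrom𝔹 : Corner → Corner
twist𝔹 (false , h) = false , not h
twist𝔹 (true , h) = true , h
dualTo𝔹 (false , false) = false , true
dualTo𝔹 (false , true) = true , false
dualTo𝔹 (true , false) = true , true
dualTo𝔹 (true , true) = false , false
dualFrom𝔹 (false , false) = true , true
dualFrom𝔹 (false , true) = false , false
dualFrom𝔹 (true , false) = false , true
dualFrom𝔹 (true , true) = true , false

-- The black split at e joins the two ends of each arrow of e.
black𝔹 : Corner → Corner
black𝔹 (a , h) = a , not h

state𝔹 : Bool → Corner → Corner
state𝔹 true (a , h) = not a , h
state𝔹 false (a , h) = not a , not h

module _ {n} (e : Fin (suc n)) where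

  twistMap-local : IsLocal e (twistMap e) twist𝔹
  twistMap-local .fixes-up p rewrite isEdge-upPt e p = refl
  twistMap-local .acts-on-e false h rewrite isEdge-self e false h = refl
  twistMap-local .acts-on-e true h rewrite isEdge-self e true h = refl

  dualTo-local : IsLocal e (dualTo e) dualTo𝔹
  dualTo-local .fixes-up p rewrite isEdge-upPt e p = refl
  dualTo-local .acts-on-e false false rewrite isEdge-self e false false = refl
  dualTo-local .acts-on-e false true rewrite isEdge-self e false true = refl
  dualTo-local .acts-on-e true false rewrite isEdge-self e true false = refl
  dualTo-local .acts-on-e true true rewrite isEdge-self e true true = refl

  dualFrom-local : IsLocal e (dualFrom e) dualFrom𝔹
  dualFrom-local .fixes-up p rewrite isEdge-upPt e p = refl
  dualFrom-local .acts-on-e false false rewrite isEdge-self e false false = refl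
  dualFrom-local .acts-on-e false true rewrite isEdge-self e false true = refl
  dualFrom-local .acts-on-e true false rewrite isEdge-self e true false = refl
  dualFrom-local .acts-on-e true true rewrite isEdge-self e true true = refl

agreeOnCorners : (Corner → Corner) → (Corner → Corner) → Bool
agreeOnCorners F G = allᵇ (λ c → ⌊ F c ≟ᶜ G c ⌋) corners

≗-by-corners : ∀ {F G} {agree : T (agreeOnCorners F G)} → ∀ c → F c ≡ G c
≗-by-corners {F} {G} {agree} c = toWitness (allᵇ⁻ {f = λ c → ⌊ F c ≟ᶜ G c ⌋} agree (∈-corners c))

blackAt : ∀ {m} → Fin m → Vec Bool m → Point m → Point m
blackAt e s (x , a , h) = if isEdge e (x , a , h) then (x , a , not h) else statePair s (x , a , h)

statePair-invol : ∀ {m} (s : Vec Bool m) p → statePair s (statePair s p) ≡ p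
statePair-invol s (x , a , h) with lookup s x in eq
... | true rewrite eq = cong (λ a → x , a , h) (not-involutive a)
... | false rewrite eq = cong₂ (λ a h → x , a , h) (not-involutive a) (not-involutive h)

module _ {n} (e : Fin (suc n)) (s : Vec Bool n) where

  statePair-insertAt-up : ∀ b p → statePair (insertAt s e b) (upPt e p) ≡ upPt e (statePair s p)
  statePair-insertAt-up b (y , a , h) rewrite insertAt-punchIn s e b y with lookup s y
  ... | true = refl
  ... | false = refl

  statePair-insertAt-e : ∀ b a h → statePair (insertAt s e b) (e , a , h) ≡ (e , state𝔹 b (a , h))
  statePair-insertAt-e true a h rewrite insertAt-lookup s e true = refl
  statePair-insertAt-e false a h rewrite insertAt-lookup s e false = refl

  blackAt-up : ∀ b p → blackAt e (insertAt s e b) (upPt e p) ≡ upPt e (statePair s p)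
  blackAt-up b p rewrite isEdge-upPt e p = statePair-insertAt-up b p

  blackAt-e : ∀ b a h → blackAt e (insertAt s e b) (e , a , h) ≡ (e , a , not h)
  blackAt-e b a h rewrite isEdge-self e a h = refl

numCurves-insertAt-delete : ∀ {n} (e : Fin (suc n)) (X K : AP (suc n)) → Valid X → iso K ≡ iso X →
  ∀ {ψ ψ⁻¹ f f⁻¹} → IsLocal e ψ f → IsLocal e ψ⁻¹ f⁻¹ → (∀ c → f (f⁻¹ c) ≡ c) → (∀ c → f⁻¹ (f c) ≡ c) →
  (∀ p → σ K p ≡ ψ (σ X (ψ⁻¹ p))) →
  ∀ b → (∀ c → state𝔹 b c ≡ f (black𝔹 (f⁻¹ c))) →
  ∀ s → numCurves K (insertAt s e b) ≡ numCurves (delete X e) s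
numCurves-insertAt-delete e X K (σ-invol , σ-fpf) iso≡ {ψ} {ψ⁻¹} {f} {f⁻¹} ψ-local ψ⁻¹-local ff⁻¹ f⁻¹f σK≗ b state≗ s = begin
  numCurves K (insertAt s e b)                          ≡⟨ numCurves-count K (insertAt s e b) ⟩
  iso K + count (isRep K (insertAt s e b))              ≡⟨ cong₂ _+_ iso≡ Conj.count-isLeast-conjugate ⟩
  iso X + count Del.G.isLeast                           ≡⟨ cong (iso X +_) Del.count-isLeast-deletion ⟩
  iso X + (onlyECircles X e + count Del.D.isLeast)      ≡⟨ +-assoc (iso X) _ _ ⟨
  iso (delete X e) + count (isRep (delete X e) s)       ≡⟨ numCurves-count (delete X e) s ⟨
  numCurves (delete X e) s                              ∎
  where
  open ≡-Reasoning
  module Del = Deletion e X σ-invol σ-fpf {blackAt e (insertAt s e b)} {statePair s} (statePair-invol s)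
    (blackAt-up e s b) (blackAt-e e s b) {σ (delete X e)} (λ _ → refl)
  π≗ : ∀ p → statePair (insertAt s e b) p ≡ ψ (blackAt e (insertAt s e b) (ψ⁻¹ p))
  π≗ p with edgeView e p
  ... | off-e q = sym (begin
    ψ (blackAt e (insertAt s e b) (ψ⁻¹ (upPt e q)))  ≡⟨ cong (ψ ∘ blackAt e (insertAt s e b)) (ψ⁻¹-local .fixes-up q) ⟩
    ψ (blackAt e (insertAt s e b) (upPt e q))        ≡⟨ cong ψ (blackAt-up e s b q) ⟩
    ψ (upPt e (statePair s q))                       ≡⟨ ψ-local .fixes-up _ ⟩
    upPt e (statePair s q)                           ≡⟨ statePair-insertAt-up e s b q ⟨
    statePair (insertAt s e b) (upPt e q)            ∎)
  ... | on-e a h = let c = f⁻¹ (a , h) in begin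
    statePair (insertAt s e b) (e , a , h)           ≡⟨ statePair-insertAt-e e s b a h ⟩
    e , state𝔹 b (a , h)                             ≡⟨ cong (e ,_) (state≗ (a , h)) ⟩
    e , f (black𝔹 c)                                 ≡⟨ ψ-local .acts-on-e _ _ ⟨
    ψ (e , black𝔹 c)                                 ≡⟨ cong ψ (blackAt-e e s b _ _) ⟨
    ψ (blackAt e (insertAt s e b) (e , c))           ≡⟨ cong (ψ ∘ blackAt e (insertAt s e b)) (ψ⁻¹-local .acts-on-e a h) ⟨
    ψ (blackAt e (insertAt s e b) (ψ⁻¹ (e , a , h))) ∎
  module Conj = Conjugate {ψ = ψ} {ψ⁻¹} (IsLocal-inverse ψ-local ψ⁻¹-local ff⁻¹) (IsLocal-inverse ψ⁻¹-local ψ-local f⁻¹f)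
    {σ X} {blackAt e (insertAt s e b)} σ-invol Del.π-invol σK≗ π≗

numCurves-insertAt-delete′ : ∀ {n} (e : Fin (suc n)) (K X : AP (suc n)) → Valid K → iso K ≡ iso X →
  ∀ {ψ ψ⁻¹ f f⁻¹} → IsLocal e ψ f → IsLocal e ψ⁻¹ f⁻¹ → (∀ c → f (f⁻¹ c) ≡ c) → (∀ c → f⁻¹ (f c) ≡ c) →
  (∀ p → σ X p ≡ ψ⁻¹ (σ K (ψ p))) →
  ∀ b → (∀ c → state𝔹 b c ≡ f (black𝔹 (f⁻¹ c))) →
  ∀ s → numCurves K (insertAt s e b) ≡ numCurves (delete X e) s
numCurves-insertAt-delete′ e K X valid iso≡ {ψ} {ψ⁻¹} ψ-local ψ⁻¹-local ff⁻¹ f⁻¹f σX≗ =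
  numCurves-insertAt-delete e X K (Valid-conjugate {ψ = ψ⁻¹} {ψ} ψ⁻¹ψ ψψ⁻¹ {K} {X} σX≗ valid) iso≡ ψ-local ψ⁻¹-local ff⁻¹ f⁻¹f
    (conjugate-sym {ψ = ψ⁻¹} {ψ} ψ⁻¹ψ ψψ⁻¹ {σ K} {σ X} σX≗)
  where
  ψψ⁻¹ = IsLocal-inverse ψ-local ψ⁻¹-local ff⁻¹
  ψ⁻¹ψ = IsLocal-inverse ψ⁻¹-local ψ-local f⁻¹f

module _ {n} (G : AP (suc n)) (valid : Valid G) (e : Fin (suc n)) where

  dualTo∘dualFrom : ∀ p → dualTo e (dualFrom e p) ≡ p
  dualTo∘dualFrom = IsLocal-inverse (dualTo-local e) (dualFrom-local e) ≗-by-corners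

  dualFrom∘dualTo : ∀ p → dualFrom e (dualTo e p) ≡ p
  dualFrom∘dualTo = IsLocal-inverse (dualFrom-local e) (dualTo-local e) ≗-by-corners

  valid-pdual : Valid (pdual e G)
  valid-pdual = Valid-conjugate {ψ = dualFrom e} {dualTo e} dualFrom∘dualTo dualTo∘dualFrom {G} {pdual e G} (λ _ → refl) valid

  dual-twist-local : IsLocal e (dualFrom e ∘ twistMap e ∘ dualTo e) (dualFrom𝔹 ∘ twist𝔹 ∘ dualTo𝔹)
  dual-twist-local = IsLocal-∘ (dualFrom-local e) (IsLocal-∘ (twistMap-local e) (dualTo-local e))

  σ-dual-twist : ∀ p → σ (pdual e (twist e G)) p ≡ (dualFrom e ∘ twistMap e ∘ dualTo e) (σ (pdual e G) ((dualFrom e ∘ twistMap e ∘ dualTo e) p))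
  σ-dual-twist p = cong (dualFrom e ∘ twistMap e) (sym (trans (dualTo∘dualFrom (σ G (dualTo e (dualFrom e (twistMap e (dualTo e p))))))
                                                     (cong (σ G) (dualTo∘dualFrom (twistMap e (dualTo e p))))))

  numCurves-white : ∀ s → numCurves G (insertAt s e false) ≡ numCurves (contract G e) s
  numCurves-white = numCurves-insertAt-delete′ e G (pdual e G) valid refl (dualTo-local e) (dualFrom-local e)
    ≗-by-corners ≗-by-corners (λ _ → refl) false ≗-by-corners

  numCurves-crossing : ∀ s → numCurves G (insertAt s e true) ≡ numCurves (contract (twist e G) e) s
  numCurves-crossing = numCurves-insertAt-delete′ e G (pdual e (twist e G)) valid refl
    (IsLocal-∘ (twistMap-local e) (dualTo-local e)) (IsLocal-∘ (dualFrom-local e) (twistMap-local e))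
    ≗-by-corners ≗-by-corners (λ _ → refl) true ≗-by-corners

  numCurves-crossing′ : ∀ s → numCurves G (insertAt s e true) ≡ numCurves (contract (twist e (pdual e G)) e) s
  numCurves-crossing′ = numCurves-insertAt-delete′ e G (pdual e (twist e (pdual e G))) valid refl
    (IsLocal-∘ (dualTo-local e) (IsLocal-∘ (twistMap-local e) (dualTo-local e)))
    (IsLocal-∘ (dualFrom-local e) (IsLocal-∘ (twistMap-local e) (dualFrom-local e)))
    ≗-by-corners ≗-by-corners (λ _ → refl) true ≗-by-corners

  numCurves-δτ-white : ∀ s → numCurves (pdual e (twist e G)) (insertAt s e false) ≡ numCurves (delete G e) s
  numCurves-δτ-white = numCurves-insertAt-delete e G (pdual e (twist e G)) valid refl
    (IsLocal-∘ (dualFrom-local e) (twistMap-local e)) (IsLocal-∘ (twistMap-local e) (dualTo-local e))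
    ≗-by-corners ≗-by-corners (λ _ → refl) false ≗-by-corners

  numCurves-δτ-crossing : ∀ s → numCurves (pdual e (twist e G)) (insertAt s e true) ≡ numCurves (contract G e) s
  numCurves-δτ-crossing = numCurves-insertAt-delete e (pdual e G) (pdual e (twist e G)) valid-pdual refl dual-twist-local dual-twist-local
    ≗-by-corners ≗-by-corners σ-dual-twist true ≗-by-corners

theorem5p6 : ∀ {n : ℕ} (G : AP (suc n)) → Valid G → (e : Fin (suc n)) → (k : ℕ) →
    (penroseCoeff G k
       ≡ (penroseCoeff (contract G e) −P penroseCoeff (contract (twist e G) e)) k)
  × (penroseCoeff G k
       ≡ (penroseCoeff (contract G e) −P penroseCoeff (contract (twist e (pdual e G)) e)) k)
  × (penroseCoeff (pdual e (twist e G)) k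
       ≡ (penroseCoeff (delete G e) −P penroseCoeff (contract G e)) k)
theorem5p6 G valid e k =
    penroseCoeff-split e G (contract G e) (contract (twist e G) e)
      (numCurves-white G valid e) (numCurves-crossing G valid e) k
  , penroseCoeff-split e G (contract G e) (contract (twist e (pdual e G)) e)
      (numCurves-white G valid e) (numCurves-crossing′ G valid e) k
  , penroseCoeff-split e (pdual e (twist e G)) (delete G e) (contract G e)
      (numCurves-δτ-white G valid e) (numCurves-δτ-crossing G valid e) k
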